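{- For every odd integer $t\geq 73$, $\chi_{\rho}(G(\mathbb{Z},\{1,t\}))\leq 86$.
   Context: For a graph $G$, a packing $k$-coloring is a map $f:V(G)\to\{1,\ldots,k\}$ such that any two distinct vertices $u,v$ with $f(u)=f(v)=i$ satisfy $d_G(u,v)\geq i+1$. The packing chromatic number $\chi_{\rho}(G)$ is the least $k$ for which a packing $k$-coloring exists. $G(\mathbb{Z},D)$ is the graph on $\mathbb{Z}$ with $i,j$ adjacent iff $|i-j|\in D$. -}

module Defs where

open import Data.Nat using (ℕ; zero; suc; _≤_)
open import Data.Integer using (ℤ; ∣_∣; _-_)
open import Data.Fin using (Fin; toℕ)
open import Data.Product using (Σ; _×_; ∃)
open import Data.Sum using (_⊎_)
open import Relation.Binary.PropositionalEquality using (_≡_)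
open import Relation.Nullary using (¬_)

Adj : (D : ℕ → Set) → ℤ → ℤ → Set
Adj D i j = D ∣ i - j ∣

data Walk (D : ℕ → Set) : ℤ → ℤ → ℕ → Set where
  here : ∀ {u} → Walk D u u zero
  step : ∀ {u v w n} → Adj D u v → Walk D v w n → Walk D u w (suc n)

-- d_G(u,v) ≥ m  iff  there is no walk from u to v of length < m.
DistGE : (D : ℕ → Set) → ℤ → ℤ → ℕ → Set
DistGE D u v m = ∀ n → suc n ≤ m → ¬ Walk D u v n

-- Colour c : Fin k stands for colour toℕ c + 1 ∈ {1,…,k}.
IsPackingColoring : (D : ℕ → Set) (k : ℕ) → (ℤ → Fin k) → Set
IsPackingColoring D k f =
  ∀ u v → ¬ (u ≡ v) → f u ≡ f v → DistGE D u v (suc (suc (toℕ (f u))))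

PackingChromaticLE : (D : ℕ → Set) → ℕ → Set
PackingChromaticLE D k = Σ (ℤ → Fin k) (IsPackingColoring D k)

OneT : ℕ → ℕ → Set
OneT t d = (d ≡ 1) ⊎ (d ≡ t)

module Submission where

-- Write t = 4N + σ with σ = ±1, N ≥ 18, and place x = ℓ + 4(w + QN) in lane ℓ < 4,
-- column w < N and row Q.  The even lanes are independent (t is odd) and get colour 1,
-- lane 1 alternates colours 2 and 3 down the rows, and lane 3 reads, in column w and row
-- Q, entry Q mod 48 of a word of colours in [4, 71] attached to column w.  A walk of
-- length n inside one lane moves by A + Bt with |A| + |B| ≤ n; this forces it either to
-- cross d ≥ 1 columns around the cycle of columns, at cost 4d, or to stay in its column
-- and move |B| rows, at cost 2|B| (LaneGeometry).  Hence a lane colouring is a packing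
-- colouring once each colour c recurs in a column only after more than c/2 rows and is
-- shared by columns d apart only if c < 4d.  For lane 3 these properties of the explicit
-- column words are established by a certificate computed for each residue of N mod 8
-- (ColumnWords, ColumnCycle); the pieces are assembled in Colouring.

open import Defs
open import Data.Nat using (ℕ; _≤_; _%_)
open import Relation.Binary.PropositionalEquality using (_≡_)

import Data.Integer as ℤ
open import Data.Bool using (Bool; true; false; _∧_; _∨_; not; T; if_then_else_)
open import Data.Bool.Properties using (T-∧; T-∨)
open import Data.List using (List; []; _∷_; _++_; length)
open import Data.Bool.ListAction using (all; any)
open import Data.List.Properties using (length-++)
open import Data.Product using (Σ; _×_; _,_; proj₁; proj₂)
open import Data.Sum using (_⊎_; inj₁; inj₂) renaming (map to ⊎-map)
open import Data.Empty using (⊥; ⊥-elim)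
open import Function using (Equivalence; _∘_)
open import Relation.Nullary using (¬_; Dec; yes; no)
open import Relation.Binary.PropositionalEquality using (_≢_; refl; sym; trans; cong; cong₂; subst; subst₂; module ≡-Reasoning)

module FiniteChecks where
  open import Data.Nat using (zero; suc; _+_; _*_; _<_; _<ᵇ_; _≡ᵇ_; s≤s⁻¹)
  open import Data.Nat.Properties

  ∧-elim : ∀ {a b} → T (a ∧ b) → T a × T b
  ∧-elim = Equivalence.to T-∧

  ∨-elim : ∀ {a b} → T (a ∨ b) → T a ⊎ T b
  ∨-elim = Equivalence.to T-∨

  if-yes : ∀ {A : Set} {b} {x y : A} → T b → (if b then x else y) ≡ x
  if-yes {b = true} _ = refl

  if-no : ∀ {A : Set} {b} {x y : A} → ¬ T b → (if b then x else y) ≡ y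
  if-no {b = false} _  = refl
  if-no {b = true}  ¬b = ⊥-elim (¬b _)

  not-T : ∀ {b} → T b → T (not b) → ⊥
  not-T {true} _ ()

  all< : ℕ → (ℕ → Bool) → Bool
  all< zero    p = true
  all< (suc n) p = all< n p ∧ p n

  all<-sound : ∀ n p → T (all< n p) → ∀ {i} → i < n → T (p i)
  all<-sound (suc n) p ok {i} i<1+n with m≤n⇒m<n∨m≡n (s≤s⁻¹ i<1+n)
  ... | inj₁ i<n  = all<-sound n p (proj₁ (∧-elim ok)) i<n
  ... | inj₂ refl = proj₂ (∧-elim ok)

  all<²-sound : ∀ m n (p : ℕ → ℕ → Bool) → T (all< m (λ i → all< n (p i))) →
                ∀ {i j} → i < m → j < n → T (p i j)
  all<²-sound m n p ok {i} i<m j<n = all<-sound n (p i) (all<-sound m (λ i → all< n (p i)) ok i<m) j<n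

  _∈ᵇ_ : ℕ → List ℕ → Bool
  c ∈ᵇ xs = any (_≡ᵇ c) xs

  all-sound : ∀ p xs {c} → T (all p xs) → T (c ∈ᵇ xs) → T (p c)
  all-sound p (x ∷ xs) ok c∈ with ∧-elim ok | ∨-elim c∈
  ... | px , _   | inj₁ x≡c = subst (λ y → T (p y)) (≡ᵇ⇒≡ x _ x≡c) px
  ... | _  , pxs | inj₂ c∈xs = all-sound p xs pxs c∈xs

  -- On the cycle ℤ/m the point y lies d steps after x.
  Ahead : ℕ → ℕ → ℕ → ℕ → Set
  Ahead m x y d = y ≡ x + d ⊎ y + m ≡ x + d

  -- entry p k : the k-th entry of p (0 past the end).
  entry : List ℕ → ℕ → ℕ
  entry []       _       = 0
  entry (x ∷ xs) zero    = x
  entry (x ∷ xs) (suc k) = entry xs k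

  member : ∀ {c p q} → p ≡ q → T (c ∈ᵇ p) → T (c ∈ᵇ q)
  member {c} eq = subst (λ p → T (c ∈ᵇ p)) eq

  entry-∈ : ∀ p {k} → k < length p → T (entry p k ∈ᵇ p)
  entry-∈ (x ∷ p) {zero}  _   = Equivalence.from T-∨ (inj₁ (≡⇒≡ᵇ x x refl))
  entry-∈ (x ∷ p) {suc k} k<n = Equivalence.from T-∨ (inj₂ (entry-∈ p (s≤s⁻¹ k<n)))

  entry-++ˡ : ∀ p q {k} → k < length p → entry (p ++ q) k ≡ entry p k
  entry-++ˡ (x ∷ p) q {zero}  _   = refl
  entry-++ˡ (x ∷ p) q {suc k} k<n = entry-++ˡ p q (s≤s⁻¹ k<n)

  entry-++ʳ : ∀ p q k → entry (p ++ q) (length p + k) ≡ entry q k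
  entry-++ʳ []      q k = refl
  entry-++ʳ (x ∷ p) q k = entry-++ʳ p q k

  -- Reading the doubled word p ++ p at k + d walks d steps around the cycle of p.
  entry-doubled : ∀ p {k k' d} → k' < length p → Ahead (length p) k k' d →
                  entry (p ++ p) (k + d) ≡ entry p k'
  entry-doubled p k'<m (inj₁ k'≡) = trans (cong (entry (p ++ p)) (sym k'≡)) (entry-++ˡ p p k'<m)
  entry-doubled p {k' = k'} k'<m (inj₂ k'+m≡) =
    trans (cong (entry (p ++ p)) (trans (sym k'+m≡) (+-comm k' (length p)))) (entry-++ʳ p p k')

  spreadFrom : ℕ → ℕ → List ℕ → Bool
  spreadFrom c δ []       = true
  spreadFrom c δ (x ∷ xs) = (not (x ≡ᵇ c) ∨ (c <ᵇ 2 * δ)) ∧ spreadFrom c (suc δ) xs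

  spread : ℕ → List ℕ → Bool
  spread zero    xs       = true
  spread (suc k) []       = true
  spread (suc k) (x ∷ xs) = spreadFrom x 1 xs ∧ spread k xs

  spreadFrom-sound : ∀ c δ xs → T (spreadFrom c δ xs) → ∀ {i} → i < length xs →
                     entry xs i ≡ c → c < 2 * (δ + i)
  spreadFrom-sound c δ (x ∷ xs) ok {zero} _ refl with ∨-elim (proj₁ (∧-elim ok))
  ... | inj₁ x≢x  = ⊥-elim (not-T (≡⇒≡ᵇ x x refl) x≢x)
  ... | inj₂ x<2δ = subst (λ e → x < 2 * e) (sym (+-identityʳ δ)) (<ᵇ⇒< x _ x<2δ)
  spreadFrom-sound c δ (x ∷ xs) ok {suc i} i<n xs[i]≡c =
    subst (λ e → c < 2 * e) (sym (+-suc δ i))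
      (spreadFrom-sound c (suc δ) xs (proj₂ (∧-elim ok)) (s≤s⁻¹ i<n) xs[i]≡c)

  spread-sound : ∀ k xs → T (spread k xs) → ∀ {j d} → j < k → j + suc d < length xs →
                 entry xs (j + suc d) ≡ entry xs j → entry xs j < 2 * suc d
  spread-sound (suc k) (x ∷ xs) ok {zero}  _   j+d<n same =
    spreadFrom-sound x 1 xs (proj₁ (∧-elim ok)) (s≤s⁻¹ j+d<n) same
  spread-sound (suc k) (x ∷ xs) ok {suc j} j<k j+d<n same =
    spread-sound k xs (proj₂ (∧-elim ok)) (s≤s⁻¹ j<k) (s≤s⁻¹ j+d<n) same

  -- A cyclic word p is well spread if equal entries d < |p| steps apart (cyclically)
  -- carry a colour below 2d; this is decided by scanning the doubled word.
  WellSpread : List ℕ → Bool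
  WellSpread p = spread (length p) (p ++ p)

  well-spread-sound : ∀ p → T (WellSpread p) → ∀ {k k' d} → k < length p → k' < length p →
                      0 < d → d < length p → Ahead (length p) k k' d →
                      entry p k ≡ entry p k' → entry p k < 2 * d
  well-spread-sound p ok {k} {k'} {suc d} k<m k'<m _ d<m ahead same =
    subst (_< 2 * suc d) p[k]≡ (spread-sound (length p) (p ++ p) ok k<m bound repeat)
    where
    p[k]≡ : entry (p ++ p) k ≡ entry p k
    p[k]≡ = entry-++ˡ p p k<m
    bound : k + suc d < length (p ++ p)
    bound = subst (k + suc d <_) (sym (length-++ p)) (+-mono-< k<m d<m)
    repeat : entry (p ++ p) (k + suc d) ≡ entry (p ++ p) k
    repeat = trans (entry-doubled p {k} {k'} {suc d} k'<m ahead) (trans (sym same) (sym p[k]≡))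

  separated : ℕ → List ℕ → List ℕ → Bool
  separated b S S' = all (λ c → not (c ∈ᵇ S') ∨ (c <ᵇ b)) S

  separated-sound : ∀ b S S' {c} → T (separated b S S') → T (c ∈ᵇ S) → T (c ∈ᵇ S') → c < b
  separated-sound b S S' {c} ok c∈S c∈S' with ∨-elim (all-sound _ S ok c∈S)
  ... | inj₁ c∉S' = ⊥-elim (not-T c∈S' c∉S')
  ... | inj₂ c<b  = <ᵇ⇒< c b c<b

  palette : List ℕ → List ℕ
  palette []       = []
  palette (x ∷ xs) = if x ∈ᵇ xs then palette xs else x ∷ palette xs

  palette-⊇ : ∀ xs {c} → T (c ∈ᵇ xs) → T (c ∈ᵇ palette xs)
  palette-⊇ (x ∷ xs) {c} c∈ with x ∈ᵇ xs in x∈? | ∨-elim c∈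
  ... | true  | inj₂ c∈xs = palette-⊇ xs c∈xs
  ... | true  | inj₁ x≡c  = subst (λ y → T (y ∈ᵇ palette xs)) (≡ᵇ⇒≡ x c x≡c)
                               (palette-⊇ xs (subst T (sym x∈?) _))
  ... | false | inj₁ x≡c  = Equivalence.from T-∨ (inj₁ x≡c)
  ... | false | inj₂ c∈xs = Equivalence.from T-∨ (inj₂ (palette-⊇ xs c∈xs))

module Displacement where
  open import Data.Integer hiding (_≤_; _<_)
  open import Data.Integer.Properties using (∣i+j∣≤∣i∣+∣j∣; ∣i-j∣≡∣j-i∣; +-inverseʳ)
  open import Data.Integer.Tactic.RingSolver using (solve-∀)
  import Data.Nat as ℕ
  import Data.Nat.Properties as ℕP
  open import Algebra.Properties.CommutativeSemigroup ℕP.+-commutativeSemigroup using (interchange)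

  -- v - u = A + B·t, where the walk makes A net unit steps and B net t-steps;
  -- a walk of length n achieves this with |A| + |B| ≤ n.
  record Displacement (t : ℕ) (u v : ℤ) (n : ℕ) : Set where
    constructor displacement
    field
      A B   : ℤ
      moves : v - u ≡ A + B * + t
      cost  : ∣ A ∣ ℕ.+ ∣ B ∣ ≤ n

  compose : ∀ {t u w v m n} → Displacement t u w m → Displacement t w v n →
            Displacement t u v (m ℕ.+ n)
  compose {t} {u} {w} {v} {m} {n} (displacement A₁ B₁ e₁ c₁) (displacement A₂ B₂ e₂ c₂) =
    displacement (A₁ + A₂) (B₁ + B₂) moves cost
    where
    open ≡-Reasoning
    split : ∀ u w v → v - u ≡ (w - u) + (v - w)
    split = solve-∀
    regroup : ∀ A₁ B₁ A₂ B₂ T → (A₁ + B₁ * T) + (A₂ + B₂ * T) ≡ (A₁ + A₂) + (B₁ + B₂) * T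
    regroup = solve-∀
    moves : v - u ≡ (A₁ + A₂) + (B₁ + B₂) * + t
    moves = begin
      v - u                                ≡⟨ split u w v ⟩
      (w - u) + (v - w)                    ≡⟨ cong₂ _+_ e₁ e₂ ⟩
      (A₁ + B₁ * + t) + (A₂ + B₂ * + t)    ≡⟨ regroup A₁ B₁ A₂ B₂ (+ t) ⟩
      (A₁ + A₂) + (B₁ + B₂) * + t          ∎
    cost : ∣ A₁ + A₂ ∣ ℕ.+ ∣ B₁ + B₂ ∣ ≤ m ℕ.+ n
    cost = ℕP.≤-trans (ℕP.+-mono-≤ (∣i+j∣≤∣i∣+∣j∣ A₁ A₂) (∣i+j∣≤∣i∣+∣j∣ B₁ B₂))
             (ℕP.≤-trans (ℕP.≤-reflexive (interchange (∣ A₁ ∣) (∣ A₂ ∣) (∣ B₁ ∣) (∣ B₂ ∣)))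
               (ℕP.+-mono-≤ c₁ c₂))

  unit-step : ∀ a T → a ≡ a + 0ℤ * T
  unit-step = solve-∀
  t-step : ∀ T → T ≡ 0ℤ + + 1 * T
  t-step = solve-∀
  t-step-back : ∀ T → - T ≡ 0ℤ + - + 1 * T
  t-step-back = solve-∀

  edge-move : ∀ t z → OneT t ∣ z ∣ → Σ ℤ λ A → Σ ℤ λ B → z ≡ A + B * + t × ∣ A ∣ ℕ.+ ∣ B ∣ ≤ 1
  edge-move t (+ 1)    (inj₁ refl) = + 1   , 0ℤ    , unit-step (+ 1) (+ t)     , ℕ.s≤s ℕ.z≤n
  edge-move t -[1+ 0 ] (inj₁ refl) = - + 1 , 0ℤ    , unit-step (- + 1) (+ t)   , ℕ.s≤s ℕ.z≤n
  edge-move _ (+ t)    (inj₂ refl) = 0ℤ    , + 1   , t-step (+ t)              , ℕ.s≤s ℕ.z≤n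
  edge-move _ -[1+ m ] (inj₂ refl) = 0ℤ    , - + 1 , t-step-back (+ ℕ.suc m)   , ℕ.s≤s ℕ.z≤n

  edge : ∀ {t u w} → Adj (OneT t) u w → Displacement t u w 1
  edge {t} {u} {w} adj with edge-move t (w - u) (subst (OneT t) (∣i-j∣≡∣j-i∣ u w) adj)
  ... | A , B , w-u≡ , cost = displacement A B w-u≡ cost

  walk-displacement : ∀ {t u v n} → Walk (OneT t) u v n → Displacement t u v n
  walk-displacement {u = u} here = displacement 0ℤ 0ℤ (+-inverseʳ u) ℕ.z≤n
  walk-displacement (step adj walk) = compose (edge adj) (walk-displacement walk)

module CyclicOffsets where
  open import Data.Integer hiding (_≤_; _<_)
  open import Data.Integer.Properties using (pos-+; pos-*; neg-distribˡ-*; +-injective; +-identityˡ)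
  open import Data.Integer.Tactic.RingSolver using (solve-∀)
  open import Data.Nat using (_<_)
  import Data.Nat as ℕ
  import Data.Nat.Properties as ℕP
  open FiniteChecks using (Ahead)

  pos-+* : ∀ a b c → + (a ℕ.+ b ℕ.* c) ≡ + a + + b * + c
  pos-+* a b c = trans (pos-+ a (b ℕ.* c)) (cong (λ z → + a + z) (pos-* b c))

  neg-* : ∀ j M → -[1+ j ] * + M ≡ - + (ℕ.suc j ℕ.* M)
  neg-* j M = trans (sym (neg-distribˡ-* (+ ℕ.suc j) (+ M))) (cong -_ (sym (pos-* (ℕ.suc j) M)))

  forward : ∀ M x y d j → + y - + x ≡ + d + + j * + M → y ≡ x ℕ.+ (d ℕ.+ j ℕ.* M)
  forward M x y d j e = +-injective (begin
    + y                             ≡⟨ identity (+ y) (+ x) ⟩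
    + x + (+ y - + x)               ≡⟨ cong (λ z → + x + z) e ⟩
    + x + (+ d + + j * + M)         ≡⟨ cong (λ z → + x + z) (sym (pos-+* d j M)) ⟩
    + x + + (d ℕ.+ j ℕ.* M)         ≡⟨ sym (pos-+ x _) ⟩
    + (x ℕ.+ (d ℕ.+ j ℕ.* M))       ∎)
    where
    open ≡-Reasoning
    identity : ∀ y x → y ≡ x + (y - x)
    identity = solve-∀

  backward : ∀ M x y d j → + y - + x ≡ + d + -[1+ j ] * + M → y ℕ.+ ℕ.suc j ℕ.* M ≡ x ℕ.+ d
  backward M x y d j e = +-injective (begin
    + (y ℕ.+ ℕ.suc j ℕ.* M)                        ≡⟨ pos-+ y _ ⟩
    + y + + (ℕ.suc j ℕ.* M)                        ≡⟨ identity (+ y) (+ x) (+ (ℕ.suc j ℕ.* M)) ⟩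
    + x + (+ y - + x + + (ℕ.suc j ℕ.* M))          ≡⟨ cong (λ z → + x + (z + + (ℕ.suc j ℕ.* M))) e ⟩
    + x + (+ d + -[1+ j ] * + M + + (ℕ.suc j ℕ.* M)) ≡⟨ cong (λ z → + x + (+ d + z + + (ℕ.suc j ℕ.* M))) (neg-* j M) ⟩
    + x + (+ d + - + (ℕ.suc j ℕ.* M) + + (ℕ.suc j ℕ.* M)) ≡⟨ identity′ (+ x) (+ d) (+ (ℕ.suc j ℕ.* M)) ⟩
    + x + + d                                      ≡⟨ sym (pos-+ x d) ⟩
    + (x ℕ.+ d)                                    ∎)
    where
    open ≡-Reasoning
    identity : ∀ y x m → y + m ≡ x + (y - x + m)
    identity = solve-∀
    identity′ : ∀ x d m → x + (d + - m + m) ≡ x + d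
    identity′ = solve-∀

  wrap-cases : ∀ M x y d K → x < M → y < M → d < M → + y - + x ≡ + d + K * + M →
               (K ≡ 0ℤ × y ≡ x ℕ.+ d) ⊎ (K ≡ -1ℤ × y ℕ.+ M ≡ x ℕ.+ d)
  wrap-cases M x y d (+ 0) x<M y<M d<M e =
    inj₁ (refl , trans (forward M x y d 0 e) (cong (x ℕ.+_) (ℕP.+-identityʳ d)))
  wrap-cases M x y d +[1+ i ] x<M y<M d<M e =
    ⊥-elim (ℕP.<⇒≱ y<M (subst (M ℕ.≤_) (sym (forward M x y d (ℕ.suc i) e))
      (ℕP.≤-trans (ℕP.m≤m+n M (i ℕ.* M)) (ℕP.≤-trans (ℕP.m≤n+m _ d) (ℕP.m≤n+m _ x)))))
  wrap-cases M x y d -[1+ 0 ] x<M y<M d<M e =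
    inj₂ (refl , trans (cong (y ℕ.+_) (sym (ℕP.+-identityʳ M))) (backward M x y d 0 e))
  wrap-cases M x y d -[1+ ℕ.suc i ] x<M y<M d<M e =
    ⊥-elim (ℕP.<⇒≱ (ℕP.+-mono-< x<M d<M) (subst (M ℕ.+ M ℕ.≤_) (backward M x y d (ℕ.suc i) e)
      (ℕP.≤-trans (ℕP.+-monoʳ-≤ M (ℕP.m≤m+n M (i ℕ.* M))) (ℕP.m≤n+m _ y))))

  cyclic-offset : ∀ M x y D K → x < M → y < M → ∣ D ∣ < M → + y - + x ≡ D + K * + M →
                  Ahead M x y ∣ D ∣ ⊎ Ahead M y x ∣ D ∣
  cyclic-offset M x y (+ d) K x<M y<M d<M e =
    inj₁ (⊎-map proj₂ proj₂ (wrap-cases M x y d K x<M y<M d<M e))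
  cyclic-offset M x y -[1+ m ] K x<M y<M d<M e =
    inj₂ (⊎-map proj₂ proj₂ (wrap-cases M y x (ℕ.suc m) (- K) y<M x<M d<M e′))
    where
    negate : ∀ a b D K M → a - b ≡ D + K * M → b - a ≡ - D + - K * M
    negate a b D K M h = trans (identity₁ a b) (trans (cong -_ h) (identity₂ D K M))
      where
      identity₁ : ∀ a b → b - a ≡ - (a - b)
      identity₁ = solve-∀
      identity₂ : ∀ D K M → - (D + K * M) ≡ - D + - K * M
      identity₂ = solve-∀
    e′ : + x - + y ≡ + ℕ.suc m + - K * + M
    e′ = negate (+ y) (+ x) -[1+ m ] K (+ M) e

  aligned : ∀ M x y K → x < M → y < M → + y - + x ≡ K * + M → y ≡ x × K ≡ 0ℤ
  aligned M x y K x<M y<M e = settle (wrap-cases M x y 0 K x<M y<M (ℕP.≤-<-trans ℕ.z≤n x<M) e′)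
    where
    e′ : + y - + x ≡ + 0 + K * + M
    e′ = trans e (sym (+-identityˡ (K * + M)))
    settle : (K ≡ 0ℤ × y ≡ x ℕ.+ 0) ⊎ (K ≡ -1ℤ × y ℕ.+ M ≡ x ℕ.+ 0) → y ≡ x × K ≡ 0ℤ
    settle (inj₁ (K≡0 , y≡x+0)) = trans y≡x+0 (ℕP.+-identityʳ x) , K≡0
    settle (inj₂ (_ , y+M≡x+0)) =
      ⊥-elim (ℕP.<⇒≱ x<M (ℕP.≤-trans (ℕP.m≤n+m M y) (ℕP.≤-reflexive (trans y+M≡x+0 (ℕP.+-identityʳ x)))))

-- Fix t = 4N + σ with σ = ±1 and cut ℤ into N columns of four lanes:
-- x = ℓ + 4 (w + Q N) lies in lane ℓ < 4, column w < N and row Q.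
module LaneGeometry (t N : ℕ) (σ : ℤ.ℤ) (t≡4N+σ : ℤ.+ t ≡ ℤ.+ 4 ℤ.* ℤ.+ N ℤ.+ σ) (∣σ∣≡1 : ℤ.∣ σ ∣ ≡ 1) where
  open import Data.Integer hiding (_≤_; _<_)
  open import Data.Integer.Properties
    using (abs-*; ∣i+j∣≤∣i∣+∣j∣; ∣-i∣≡∣i∣; ∣i∣≡0⇒i≡0; i-j≡0⇒i≡j; +-identityˡ) renaming (_≟_ to _≟ℤ_)
  open import Data.Integer.DivMod using (_%ℕ_; _/ℕ_; n%ℕd<d; a≡a%ℕn+[a/ℕn]*n)
  open import Data.Integer.Tactic.RingSolver using (solve-∀)
  open import Data.Nat using (_<_)
  import Data.Nat as ℕ
  import Data.Nat.Properties as ℕP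
  open FiniteChecks using (Ahead)
  open Displacement
  open CyclicOffsets

  position : ℕ → ℕ → ℤ → ℤ
  position ℓ w Q = + ℓ + + 4 * (+ w + Q * + N)

  ∣σ*∣ : ∀ B → ∣ σ * B ∣ ≡ ∣ B ∣
  ∣σ*∣ B = trans (abs-* σ B) (trans (cong (ℕ._* ∣ B ∣) ∣σ∣≡1) (ℕP.*-identityˡ ∣ B ∣))

  -- A displacement A + Bt between two points of lane ℓ crosses ρ columns (net, counted
  -- with the wrap-around of B - K rows), where 4ρ = A + σB.
  column-offset : ∀ {ℓ wu wv Qu Qv} A B → position ℓ wv Qv - position ℓ wu Qu ≡ A + B * + t →
                  + 4 * (+ wv - + wu - (B - (Qv - Qu)) * + N) ≡ A + σ * B
  column-offset {ℓ} {wu} {wv} {Qu} {Qv} A B moves = begin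
    + 4 * (+ wv - + wu - (B - (Qv - Qu)) * + N)                        ≡⟨ expand (+ ℓ) (+ wu) (+ wv) Qu Qv (+ N) B σ ⟩
    position ℓ wv Qv - position ℓ wu Qu - B * (+ 4 * + N + σ) + σ * B  ≡⟨ cong₂ (λ a b → a - B * b + σ * B) moves (sym t≡4N+σ) ⟩
    A + B * + t - B * + t + σ * B                                      ≡⟨ cancel A B (+ t) σ ⟩
    A + σ * B                                                          ∎
    where
    open ≡-Reasoning
    expand : ∀ ℓ wu wv Qu Qv N B σ → + 4 * (wv - wu - (B - (Qv - Qu)) * N) ≡
             (ℓ + + 4 * (wv + Qv * N)) - (ℓ + + 4 * (wu + Qu * N)) - B * (+ 4 * N + σ) + σ * B
    expand = solve-∀
    cancel : ∀ A B T σ → A + B * T - B * T + σ * B ≡ A + σ * B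
    cancel = solve-∀

  balanced : ∀ A B → A + σ * B ≡ 0ℤ → ∣ A ∣ ≡ ∣ B ∣
  balanced A B A+σB≡0 = begin
    ∣ A ∣                        ≡⟨ cong ∣_∣ (identity A (σ * B)) ⟩
    ∣ (A + σ * B) - σ * B ∣      ≡⟨ cong (λ z → ∣ z - σ * B ∣) A+σB≡0 ⟩
    ∣ 0ℤ - σ * B ∣               ≡⟨ cong ∣_∣ (+-identityˡ (- (σ * B))) ⟩
    ∣ - (σ * B) ∣                ≡⟨ ∣-i∣≡∣i∣ (σ * B) ⟩
    ∣ σ * B ∣                    ≡⟨ ∣σ*∣ B ⟩
    ∣ B ∣                        ∎
    where
    open ≡-Reasoning
    identity : ∀ A C → A ≡ (A + C) - C
    identity = solve-∀

  data LaneSeparation (wu wv : ℕ) (Qu Qv : ℤ) (n : ℕ) : Set where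
    across : ∀ d → 0 < d → 4 ℕ.* d ≤ n → Ahead N wu wv d ⊎ Ahead N wv wu d →
             LaneSeparation wu wv Qu Qv n
    along  : wu ≡ wv → 2 ℕ.* ∣ Qv - Qu ∣ ≤ n → LaneSeparation wu wv Qu Qv n

  lane-separation : ∀ {ℓ wu wv Qu Qv n} → wu < N → wv < N → n < 4 ℕ.* N →
                    Walk (OneT t) (position ℓ wu Qu) (position ℓ wv Qv) n →
                    LaneSeparation wu wv Qu Qv n
  lane-separation {ℓ} {wu} {wv} {Qu} {Qv} {n} wu<N wv<N n<4N walk
    with walk-displacement walk
  ... | displacement A B moves cost = separate (ρ ≟ℤ 0ℤ)
    where
    C ρ : ℤ
    C = B - (Qv - Qu)
    ρ = + wv - + wu - C * + N

    four-ρ : + 4 * ρ ≡ A + σ * B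
    four-ρ = column-offset {ℓ} {wu} {wv} {Qu} {Qv} A B moves

    four-∣ρ∣≤n : 4 ℕ.* ∣ ρ ∣ ≤ n
    four-∣ρ∣≤n = begin
      4 ℕ.* ∣ ρ ∣          ≡⟨ trans (sym (abs-* (+ 4) ρ)) (cong ∣_∣ four-ρ) ⟩
      ∣ A + σ * B ∣        ≤⟨ ∣i+j∣≤∣i∣+∣j∣ A (σ * B) ⟩
      ∣ A ∣ ℕ.+ ∣ σ * B ∣  ≡⟨ cong (∣ A ∣ ℕ.+_) (∣σ*∣ B) ⟩
      ∣ A ∣ ℕ.+ ∣ B ∣      ≤⟨ cost ⟩
      n                    ∎
      where open ℕP.≤-Reasoning

    columns : + wv - + wu ≡ ρ + C * + N
    columns = identity (+ wu) (+ wv) C (+ N)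
      where
      identity : ∀ wu wv C N → wv - wu ≡ (wv - wu - C * N) + C * N
      identity = solve-∀

    separate : Dec (ρ ≡ 0ℤ) → LaneSeparation wu wv Qu Qv n
    separate (no ρ≢0) = across ∣ ρ ∣ (ℕP.n≢0⇒n>0 (λ ∣ρ∣≡0 → ρ≢0 (∣i∣≡0⇒i≡0 ∣ρ∣≡0)))
      four-∣ρ∣≤n (cyclic-offset N wu wv ρ C wu<N wv<N ∣ρ∣<N columns)
      where
      ∣ρ∣<N : ∣ ρ ∣ < N
      ∣ρ∣<N = ℕP.*-cancelˡ-< 4 _ _ (ℕP.≤-<-trans four-∣ρ∣≤n n<4N)
    separate (yes ρ≡0) = along (sym (proj₁ same-column)) (subst (λ k → 2 ℕ.* ∣ k ∣ ≤ n) B≡K 2∣B∣≤n)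
      where
      same-column : wv ≡ wu × C ≡ 0ℤ
      same-column = aligned N wu wv C wu<N wv<N (trans columns (trans (cong (_+ C * + N) ρ≡0) (+-identityˡ _)))
      B≡K : B ≡ Qv - Qu
      B≡K = i-j≡0⇒i≡j B (Qv - Qu) (proj₂ same-column)
      2∣B∣≤n : 2 ℕ.* ∣ B ∣ ≤ n
      2∣B∣≤n = subst (_≤ n) (trans (cong (ℕ._+ ∣ B ∣) (balanced A B (trans (sym four-ρ) (cong (+ 4 *_) ρ≡0))))
                                  (cong (∣ B ∣ ℕ.+_) (sym (ℕP.+-identityʳ ∣ B ∣)))) cost

  -- A colouring of a lane by columns of period p: the point in column w and row Q
  -- receives colour w (Q mod p).
  record LanePattern (p : ℕ) : Set where
    field
      colour         : ℕ → ℕ → ℕ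
      along-column   : ∀ {w k k' d} → w < N → k < p → k' < p → 0 < d → d < p → Ahead p k k' d →
                       colour w k ≡ colour w k' → colour w k < 2 ℕ.* d
      across-columns : ∀ {w w' k k' d} → w < N → w' < N → k < p → k' < p → 0 < d → Ahead N w w' d →
                       colour w k ≡ colour w' k' → colour w k < 4 ℕ.* d

  lane-packing : ∀ {p} .{{_ : ℕ.NonZero p}} (P : LanePattern p) {ℓ wu wv Qu Qv n} →
                 let open LanePattern P; c = colour wu (Qu %ℕ p) in
                 wu < N → wv < N → position ℓ wu Qu ≢ position ℓ wv Qv →
                 c ≡ colour wv (Qv %ℕ p) → c < 4 ℕ.* N → c < 2 ℕ.* p → n ≤ c →
                 ¬ Walk (OneT t) (position ℓ wu Qu) (position ℓ wv Qv) n
  lane-packing {p} P {ℓ} {wu} {wv} {Qu} {Qv} {n} wu<N wv<N u≢v same c<4N c<2p n≤c walk =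
    clash (lane-separation {ℓ} {wu} {wv} {Qu} {Qv} wu<N wv<N (ℕP.≤-<-trans n≤c c<4N) walk)
    where
    open LanePattern P
    K : ℤ
    K = Qv - Qu
    ku kv : ℕ
    ku = Qu %ℕ p
    kv = Qv %ℕ p
    ku<p : ku < p
    ku<p = n%ℕd<d Qu p
    kv<p : kv < p
    kv<p = n%ℕd<d Qv p

    rows : + kv - + ku ≡ K + (Qu /ℕ p - Qv /ℕ p) * + p
    rows = trans (identity (+ ku) (+ kv) (Qu /ℕ p) (Qv /ℕ p) (+ p))
                 (cong₂ (λ x y → (y - x) + (Qu /ℕ p - Qv /ℕ p) * + p)
                        (sym (a≡a%ℕn+[a/ℕn]*n Qu p)) (sym (a≡a%ℕn+[a/ℕn]*n Qv p)))
      where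
      identity : ∀ ku kv au av P → kv - ku ≡ ((kv + av * P) - (ku + au * P)) + (au - av) * P
      identity = solve-∀

    clash : LaneSeparation wu wv Qu Qv n → ⊥
    clash (across d d>0 4d≤n (inj₁ ahead)) =
      ℕP.<⇒≱ (across-columns wu<N wv<N ku<p kv<p d>0 ahead same) (ℕP.≤-trans 4d≤n n≤c)
    clash (across d d>0 4d≤n (inj₂ ahead)) =
      ℕP.<⇒≱ (subst (_< 4 ℕ.* d) (sym same) (across-columns wv<N wu<N kv<p ku<p d>0 ahead (sym same)))
             (ℕP.≤-trans 4d≤n n≤c)
    clash (along wu≡wv 2K≤n) = row-clash (cyclic-offset p ku kv K (Qu /ℕ p - Qv /ℕ p) ku<p kv<p ∣K∣<p rows)
      where
      same′ : colour wu ku ≡ colour wu kv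
      same′ = subst (λ w → colour wu ku ≡ colour w kv) (sym wu≡wv) same
      2K≤c : 2 ℕ.* ∣ K ∣ ≤ colour wu ku
      2K≤c = ℕP.≤-trans 2K≤n n≤c
      ∣K∣<p : ∣ K ∣ < p
      ∣K∣<p = ℕP.*-cancelˡ-< 2 _ _ (ℕP.≤-<-trans 2K≤c c<2p)
      ∣K∣>0 : 0 < ∣ K ∣
      ∣K∣>0 = ℕP.n≢0⇒n>0 (λ ∣K∣≡0 →
        u≢v (cong₂ (position ℓ) wu≡wv (sym (i-j≡0⇒i≡j Qv Qu (∣i∣≡0⇒i≡0 ∣K∣≡0)))))
      row-clash : Ahead p ku kv ∣ K ∣ ⊎ Ahead p kv ku ∣ K ∣ → ⊥
      row-clash (inj₁ ahead) = ℕP.<⇒≱ (along-column wu<N ku<p kv<p ∣K∣>0 ∣K∣<p ahead same′) 2K≤c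
      row-clash (inj₂ ahead) =
        ℕP.<⇒≱ (subst (_< 2 ℕ.* ∣ K ∣) (sym same′) (along-column wu<N kv<p ku<p ∣K∣>0 ∣K∣<p ahead (sym same′))) 2K≤c

module ColumnWords where
  open import Data.Nat using (zero; suc; _+_; _*_; _∸_; _%_; _≤ᵇ_; _<ᵇ_; _≡ᵇ_)
  open import Data.Nat.Properties using (≡ᵇ⇒≡; ≤ᵇ⇒≤)
  open import Data.List using (concat; replicate; map)
  open FiniteChecks

  times : ℕ → List ℕ → List ℕ
  times n w = concat (replicate n w)

  -- pick ws q : the q-th word of ws (empty past the end).
  pick : List (List ℕ) → ℕ → List ℕ
  pick []       _       = []
  pick (w ∷ ws) zero    = w
  pick (w ∷ ws) (suc q) = pick ws q

  -- The column words.  They are opaque: only the certificate below looks inside them.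
  opaque
    -- The eight column words of the periodic region; column w uses word w mod 8.
    periodicWords : List (List ℕ)
    periodicWords =
        times 8 (4 ∷ 5 ∷ 10 ∷ 4 ∷ 5 ∷ 11 ∷ [])
      ∷ times 6 (6 ∷ 7 ∷ 12 ∷ 13 ∷ 6 ∷ 7 ∷ 14 ∷ 15 ∷ [])
      ∷ times 8 (4 ∷ 5 ∷ 8 ∷ 4 ∷ 5 ∷ 9 ∷ [])
      ∷ times 3 (6 ∷ 7 ∷ 16 ∷ 18 ∷ 6 ∷ 7 ∷ 20 ∷ 22 ∷ 6 ∷ 7 ∷ 24 ∷ 26 ∷ 6 ∷ 7 ∷ 28 ∷ 30 ∷ [])
      ∷ times 8 (4 ∷ 5 ∷ 10 ∷ 4 ∷ 5 ∷ 11 ∷ [])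
      ∷ times 6 (6 ∷ 7 ∷ 12 ∷ 13 ∷ 6 ∷ 7 ∷ 14 ∷ 15 ∷ [])
      ∷ times 8 (4 ∷ 5 ∷ 8 ∷ 4 ∷ 5 ∷ 9 ∷ [])
      ∷ times 3 (6 ∷ 7 ∷ 17 ∷ 19 ∷ 6 ∷ 7 ∷ 21 ∷ 23 ∷ 6 ∷ 7 ∷ 25 ∷ 27 ∷ 6 ∷ 7 ∷ 29 ∷ 31 ∷ [])
      ∷ []

    commonHead : List (List ℕ)
    commonHead =
        times 8 (4 ∷ 5 ∷ 10 ∷ 4 ∷ 5 ∷ 11 ∷ [])
      ∷ times 4 (6 ∷ 7 ∷ 8 ∷ 9 ∷ 6 ∷ 7 ∷ 12 ∷ 8 ∷ 6 ∷ 7 ∷ 9 ∷ 14 ∷ [])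
      ∷ (4 ∷ 5 ∷ 13 ∷ 4 ∷ 5 ∷ 15 ∷ 4 ∷ 5 ∷ 16 ∷ 4 ∷ 5 ∷ 13 ∷ 4 ∷ 5 ∷ 15 ∷ 4 ∷ 5 ∷
         16 ∷ 4 ∷ 5 ∷ 13 ∷ 4 ∷ 5 ∷ 15 ∷ 4 ∷ 5 ∷ 16 ∷ 4 ∷ 5 ∷ 13 ∷ 4 ∷ 5 ∷ 15 ∷ 4 ∷
         5 ∷ 16 ∷ 4 ∷ 5 ∷ 13 ∷ 4 ∷ 5 ∷ 15 ∷ 4 ∷ 5 ∷ 16 ∷ 4 ∷ 5 ∷ 18 ∷ [])
      ∷ times 4 (6 ∷ 10 ∷ 7 ∷ 11 ∷ 6 ∷ 20 ∷ 7 ∷ 10 ∷ 6 ∷ 11 ∷ 7 ∷ 22 ∷ [])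
      ∷ times 8 (4 ∷ 5 ∷ 8 ∷ 4 ∷ 5 ∷ 9 ∷ [])
      ∷ (6 ∷ 7 ∷ 12 ∷ 14 ∷ 6 ∷ 7 ∷ 17 ∷ 19 ∷ 6 ∷ 7 ∷ 12 ∷ 14 ∷ 6 ∷ 7 ∷ 21 ∷ 17 ∷ 6 ∷
         7 ∷ 12 ∷ 14 ∷ 6 ∷ 7 ∷ 19 ∷ 23 ∷ 6 ∷ 7 ∷ 12 ∷ 14 ∷ 6 ∷ 7 ∷ 17 ∷ 21 ∷ 6 ∷ 7 ∷
         12 ∷ 14 ∷ 6 ∷ 7 ∷ 19 ∷ 17 ∷ 6 ∷ 7 ∷ 12 ∷ 14 ∷ 6 ∷ 7 ∷ 21 ∷ 23 ∷ [])
      ∷ times 8 (4 ∷ 5 ∷ 10 ∷ 4 ∷ 5 ∷ 11 ∷ [])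
      ∷ []

    -- The 10 + r column words that close the cycle of columns when N ≡ 18 + r (mod 8).
    finalBlock : ℕ → List (List ℕ)
    finalBlock 0 = commonHead ++
      ( times 4 (6 ∷ 7 ∷ 8 ∷ 9 ∷ 6 ∷ 7 ∷ 15 ∷ 8 ∷ 6 ∷ 7 ∷ 9 ∷ 18 ∷ [])
      ∷ (4 ∷ 5 ∷ 16 ∷ 4 ∷ 5 ∷ 25 ∷ 4 ∷ 5 ∷ 27 ∷ 4 ∷ 5 ∷ 16 ∷ 4 ∷ 5 ∷ 29 ∷ 4 ∷ 5 ∷
         31 ∷ 4 ∷ 5 ∷ 16 ∷ 4 ∷ 5 ∷ 25 ∷ 4 ∷ 5 ∷ 27 ∷ 4 ∷ 5 ∷ 16 ∷ 4 ∷ 5 ∷ 29 ∷ 4 ∷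
         5 ∷ 31 ∷ 4 ∷ 5 ∷ 16 ∷ 4 ∷ 5 ∷ 27 ∷ 4 ∷ 5 ∷ 32 ∷ 4 ∷ 5 ∷ 29 ∷ [])
      ∷ (6 ∷ 7 ∷ 33 ∷ 34 ∷ 6 ∷ 7 ∷ 35 ∷ 36 ∷ 6 ∷ 7 ∷ 37 ∷ 38 ∷ 6 ∷ 7 ∷ 39 ∷ 40 ∷ 6 ∷
         7 ∷ 41 ∷ 33 ∷ 6 ∷ 7 ∷ 34 ∷ 42 ∷ 6 ∷ 7 ∷ 35 ∷ 36 ∷ 6 ∷ 7 ∷ 37 ∷ 38 ∷ 6 ∷ 7 ∷
         39 ∷ 43 ∷ 6 ∷ 7 ∷ 40 ∷ 41 ∷ 6 ∷ 7 ∷ 44 ∷ 45 ∷ 6 ∷ 7 ∷ 42 ∷ 46 ∷ [])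
      ∷ [])
    finalBlock 1 = commonHead ++
      ( times 4 (6 ∷ 7 ∷ 8 ∷ 9 ∷ 6 ∷ 7 ∷ 13 ∷ 8 ∷ 6 ∷ 7 ∷ 9 ∷ 15 ∷ [])
      ∷ (4 ∷ 5 ∷ 16 ∷ 4 ∷ 5 ∷ 18 ∷ 4 ∷ 5 ∷ 25 ∷ 4 ∷ 5 ∷ 16 ∷ 4 ∷ 5 ∷ 27 ∷ 4 ∷ 5 ∷
         18 ∷ 4 ∷ 5 ∷ 16 ∷ 4 ∷ 5 ∷ 25 ∷ 4 ∷ 5 ∷ 29 ∷ 4 ∷ 5 ∷ 16 ∷ 4 ∷ 5 ∷ 18 ∷ 4 ∷
         5 ∷ 27 ∷ 4 ∷ 5 ∷ 16 ∷ 4 ∷ 5 ∷ 25 ∷ 4 ∷ 5 ∷ 29 ∷ 4 ∷ 5 ∷ 31 ∷ [])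
      ∷ (6 ∷ 7 ∷ 32 ∷ 33 ∷ 6 ∷ 7 ∷ 38 ∷ 44 ∷ 6 ∷ 7 ∷ 46 ∷ 49 ∷ 6 ∷ 7 ∷ 50 ∷ 52 ∷ 6 ∷
         7 ∷ 53 ∷ 32 ∷ 6 ∷ 7 ∷ 33 ∷ 54 ∷ 6 ∷ 7 ∷ 38 ∷ 57 ∷ 6 ∷ 7 ∷ 44 ∷ 58 ∷ 6 ∷ 7 ∷
         46 ∷ 59 ∷ 6 ∷ 7 ∷ 61 ∷ 63 ∷ 6 ∷ 7 ∷ 67 ∷ 68 ∷ 6 ∷ 7 ∷ 69 ∷ 70 ∷ [])
      ∷ (8 ∷ 9 ∷ 17 ∷ 19 ∷ 34 ∷ 8 ∷ 9 ∷ 35 ∷ 36 ∷ 37 ∷ 8 ∷ 9 ∷ 17 ∷ 19 ∷ 39 ∷ 8 ∷ 9 ∷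
         40 ∷ 41 ∷ 42 ∷ 8 ∷ 9 ∷ 17 ∷ 19 ∷ 34 ∷ 8 ∷ 9 ∷ 35 ∷ 36 ∷ 37 ∷ 8 ∷ 9 ∷ 17 ∷
         19 ∷ 39 ∷ 8 ∷ 9 ∷ 43 ∷ 40 ∷ 41 ∷ 8 ∷ 17 ∷ 9 ∷ 42 ∷ 45 ∷ 47 ∷ 48 ∷ 51 ∷ [])
      ∷ [])
    finalBlock 2 = commonHead ++
      ( times 4 (6 ∷ 7 ∷ 8 ∷ 9 ∷ 6 ∷ 7 ∷ 13 ∷ 8 ∷ 6 ∷ 7 ∷ 9 ∷ 15 ∷ [])
      ∷ (4 ∷ 5 ∷ 16 ∷ 4 ∷ 5 ∷ 18 ∷ 4 ∷ 5 ∷ 24 ∷ 4 ∷ 5 ∷ 16 ∷ 4 ∷ 5 ∷ 27 ∷ 4 ∷ 5 ∷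
         18 ∷ 4 ∷ 5 ∷ 16 ∷ 4 ∷ 5 ∷ 24 ∷ 4 ∷ 5 ∷ 29 ∷ 4 ∷ 5 ∷ 16 ∷ 4 ∷ 5 ∷ 18 ∷ 4 ∷
         5 ∷ 27 ∷ 4 ∷ 5 ∷ 16 ∷ 4 ∷ 5 ∷ 24 ∷ 4 ∷ 5 ∷ 29 ∷ 4 ∷ 5 ∷ 31 ∷ [])
      ∷ times 6 (6 ∷ 7 ∷ 10 ∷ 11 ∷ 6 ∷ 7 ∷ 12 ∷ 14 ∷ [])
      ∷ times 8 (4 ∷ 5 ∷ 8 ∷ 4 ∷ 5 ∷ 9 ∷ [])
      ∷ (6 ∷ 7 ∷ 17 ∷ 19 ∷ 6 ∷ 7 ∷ 21 ∷ 23 ∷ 6 ∷ 7 ∷ 25 ∷ 17 ∷ 6 ∷ 7 ∷ 19 ∷ 32 ∷ 6 ∷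
         7 ∷ 21 ∷ 23 ∷ 6 ∷ 7 ∷ 17 ∷ 25 ∷ 6 ∷ 7 ∷ 19 ∷ 33 ∷ 6 ∷ 7 ∷ 21 ∷ 17 ∷ 6 ∷ 7 ∷
         23 ∷ 32 ∷ 6 ∷ 7 ∷ 19 ∷ 25 ∷ 6 ∷ 7 ∷ 21 ∷ 34 ∷ 6 ∷ 7 ∷ 33 ∷ 35 ∷ [])
      ∷ [])
    finalBlock 3 = commonHead ++
      ( times 4 (6 ∷ 7 ∷ 8 ∷ 9 ∷ 6 ∷ 7 ∷ 13 ∷ 8 ∷ 6 ∷ 7 ∷ 9 ∷ 15 ∷ [])
      ∷ (4 ∷ 5 ∷ 16 ∷ 4 ∷ 5 ∷ 18 ∷ 4 ∷ 5 ∷ 25 ∷ 4 ∷ 5 ∷ 16 ∷ 4 ∷ 5 ∷ 26 ∷ 4 ∷ 5 ∷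
         18 ∷ 4 ∷ 5 ∷ 16 ∷ 4 ∷ 5 ∷ 25 ∷ 4 ∷ 5 ∷ 28 ∷ 4 ∷ 5 ∷ 16 ∷ 4 ∷ 5 ∷ 18 ∷ 4 ∷
         5 ∷ 26 ∷ 4 ∷ 5 ∷ 16 ∷ 4 ∷ 5 ∷ 25 ∷ 4 ∷ 5 ∷ 28 ∷ 4 ∷ 5 ∷ 29 ∷ [])
      ∷ times 6 (6 ∷ 7 ∷ 10 ∷ 11 ∷ 6 ∷ 7 ∷ 12 ∷ 14 ∷ [])
      ∷ times 8 (4 ∷ 5 ∷ 8 ∷ 4 ∷ 5 ∷ 9 ∷ [])
      ∷ (6 ∷ 7 ∷ 17 ∷ 19 ∷ 6 ∷ 7 ∷ 21 ∷ 23 ∷ 6 ∷ 7 ∷ 27 ∷ 17 ∷ 6 ∷ 7 ∷ 19 ∷ 31 ∷ 6 ∷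
         7 ∷ 21 ∷ 23 ∷ 6 ∷ 7 ∷ 17 ∷ 32 ∷ 6 ∷ 7 ∷ 19 ∷ 27 ∷ 6 ∷ 7 ∷ 21 ∷ 17 ∷ 6 ∷ 7 ∷
         23 ∷ 31 ∷ 6 ∷ 7 ∷ 19 ∷ 33 ∷ 6 ∷ 7 ∷ 21 ∷ 27 ∷ 6 ∷ 7 ∷ 32 ∷ 34 ∷ [])
      ∷ (35 ∷ 36 ∷ 37 ∷ 38 ∷ 39 ∷ 40 ∷ 41 ∷ 42 ∷ 43 ∷ 44 ∷ 45 ∷ 46 ∷ 47 ∷ 48 ∷ 49 ∷
         50 ∷ 51 ∷ 52 ∷ 35 ∷ 53 ∷ 36 ∷ 37 ∷ 54 ∷ 38 ∷ 39 ∷ 55 ∷ 40 ∷ 41 ∷ 56 ∷ 42 ∷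
         43 ∷ 57 ∷ 44 ∷ 45 ∷ 58 ∷ 46 ∷ 47 ∷ 59 ∷ 60 ∷ 61 ∷ 62 ∷ 63 ∷ 64 ∷ 65 ∷ 66 ∷
         67 ∷ 68 ∷ 69 ∷ [])
      ∷ [])
    finalBlock 4 = commonHead ++
      ( times 4 (6 ∷ 7 ∷ 8 ∷ 9 ∷ 6 ∷ 7 ∷ 13 ∷ 8 ∷ 6 ∷ 7 ∷ 9 ∷ 15 ∷ [])
      ∷ (4 ∷ 5 ∷ 16 ∷ 4 ∷ 5 ∷ 18 ∷ 4 ∷ 5 ∷ 25 ∷ 4 ∷ 5 ∷ 16 ∷ 4 ∷ 5 ∷ 26 ∷ 4 ∷ 5 ∷
         18 ∷ 4 ∷ 5 ∷ 16 ∷ 4 ∷ 5 ∷ 25 ∷ 4 ∷ 5 ∷ 28 ∷ 4 ∷ 5 ∷ 16 ∷ 4 ∷ 5 ∷ 18 ∷ 4 ∷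
         5 ∷ 26 ∷ 4 ∷ 5 ∷ 16 ∷ 4 ∷ 5 ∷ 25 ∷ 4 ∷ 5 ∷ 28 ∷ 4 ∷ 5 ∷ 29 ∷ [])
      ∷ times 6 (6 ∷ 7 ∷ 10 ∷ 11 ∷ 6 ∷ 7 ∷ 12 ∷ 14 ∷ [])
      ∷ times 8 (4 ∷ 5 ∷ 8 ∷ 4 ∷ 5 ∷ 9 ∷ [])
      ∷ (6 ∷ 7 ∷ 13 ∷ 15 ∷ 6 ∷ 7 ∷ 17 ∷ 19 ∷ 6 ∷ 7 ∷ 13 ∷ 15 ∷ 6 ∷ 7 ∷ 20 ∷ 17 ∷ 6 ∷
         7 ∷ 13 ∷ 15 ∷ 6 ∷ 7 ∷ 19 ∷ 21 ∷ 6 ∷ 7 ∷ 13 ∷ 15 ∷ 6 ∷ 7 ∷ 17 ∷ 20 ∷ 6 ∷ 7 ∷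
         13 ∷ 15 ∷ 6 ∷ 7 ∷ 19 ∷ 17 ∷ 6 ∷ 7 ∷ 13 ∷ 15 ∷ 6 ∷ 7 ∷ 20 ∷ 21 ∷ [])
      ∷ (4 ∷ 5 ∷ 23 ∷ 4 ∷ 5 ∷ 27 ∷ 4 ∷ 5 ∷ 31 ∷ 4 ∷ 5 ∷ 32 ∷ 4 ∷ 5 ∷ 23 ∷ 4 ∷ 5 ∷
         33 ∷ 4 ∷ 5 ∷ 27 ∷ 4 ∷ 5 ∷ 34 ∷ 4 ∷ 5 ∷ 23 ∷ 4 ∷ 5 ∷ 31 ∷ 4 ∷ 5 ∷ 32 ∷ 4 ∷
         5 ∷ 27 ∷ 4 ∷ 5 ∷ 23 ∷ 4 ∷ 5 ∷ 33 ∷ 4 ∷ 5 ∷ 34 ∷ 4 ∷ 5 ∷ 35 ∷ [])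
      ∷ (6 ∷ 7 ∷ 8 ∷ 9 ∷ 6 ∷ 7 ∷ 38 ∷ 8 ∷ 6 ∷ 7 ∷ 9 ∷ 44 ∷ 6 ∷ 7 ∷ 8 ∷ 9 ∷ 6 ∷ 7 ∷
         50 ∷ 8 ∷ 6 ∷ 7 ∷ 9 ∷ 51 ∷ 6 ∷ 7 ∷ 8 ∷ 9 ∷ 6 ∷ 7 ∷ 38 ∷ 8 ∷ 6 ∷ 7 ∷ 9 ∷ 44 ∷
         6 ∷ 7 ∷ 8 ∷ 9 ∷ 6 ∷ 7 ∷ 52 ∷ 8 ∷ 6 ∷ 7 ∷ 9 ∷ 70 ∷ [])
      ∷ [])
    finalBlock 5 = commonHead ++
      ( times 4 (6 ∷ 7 ∷ 8 ∷ 9 ∷ 6 ∷ 7 ∷ 13 ∷ 8 ∷ 6 ∷ 7 ∷ 9 ∷ 15 ∷ [])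
      ∷ (4 ∷ 5 ∷ 16 ∷ 4 ∷ 5 ∷ 18 ∷ 4 ∷ 5 ∷ 25 ∷ 4 ∷ 5 ∷ 16 ∷ 4 ∷ 5 ∷ 26 ∷ 4 ∷ 5 ∷
         18 ∷ 4 ∷ 5 ∷ 16 ∷ 4 ∷ 5 ∷ 25 ∷ 4 ∷ 5 ∷ 28 ∷ 4 ∷ 5 ∷ 16 ∷ 4 ∷ 5 ∷ 18 ∷ 4 ∷
         5 ∷ 26 ∷ 4 ∷ 5 ∷ 16 ∷ 4 ∷ 5 ∷ 25 ∷ 4 ∷ 5 ∷ 28 ∷ 4 ∷ 5 ∷ 29 ∷ [])
      ∷ times 6 (6 ∷ 7 ∷ 10 ∷ 11 ∷ 6 ∷ 7 ∷ 12 ∷ 14 ∷ [])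
      ∷ times 8 (4 ∷ 5 ∷ 8 ∷ 4 ∷ 5 ∷ 9 ∷ [])
      ∷ (6 ∷ 7 ∷ 13 ∷ 15 ∷ 6 ∷ 7 ∷ 17 ∷ 19 ∷ 6 ∷ 7 ∷ 13 ∷ 15 ∷ 6 ∷ 7 ∷ 22 ∷ 17 ∷ 6 ∷
         7 ∷ 13 ∷ 15 ∷ 6 ∷ 7 ∷ 19 ∷ 23 ∷ 6 ∷ 7 ∷ 13 ∷ 15 ∷ 6 ∷ 7 ∷ 17 ∷ 22 ∷ 6 ∷ 7 ∷
         13 ∷ 15 ∷ 6 ∷ 7 ∷ 19 ∷ 17 ∷ 6 ∷ 7 ∷ 13 ∷ 15 ∷ 6 ∷ 7 ∷ 22 ∷ 23 ∷ [])
      ∷ times 8 (4 ∷ 5 ∷ 10 ∷ 4 ∷ 5 ∷ 11 ∷ [])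
      ∷ times 4 (6 ∷ 7 ∷ 8 ∷ 9 ∷ 6 ∷ 7 ∷ 16 ∷ 8 ∷ 6 ∷ 7 ∷ 9 ∷ 18 ∷ [])
      ∷ (21 ∷ 27 ∷ 31 ∷ 32 ∷ 33 ∷ 34 ∷ 35 ∷ 37 ∷ 39 ∷ 40 ∷ 44 ∷ 21 ∷ 45 ∷ 46 ∷ 47 ∷
         27 ∷ 48 ∷ 49 ∷ 31 ∷ 50 ∷ 32 ∷ 33 ∷ 21 ∷ 34 ∷ 35 ∷ 51 ∷ 37 ∷ 53 ∷ 39 ∷ 27 ∷
         40 ∷ 54 ∷ 55 ∷ 21 ∷ 31 ∷ 44 ∷ 45 ∷ 46 ∷ 47 ∷ 56 ∷ 57 ∷ 60 ∷ 61 ∷ 62 ∷ 63 ∷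
         66 ∷ 68 ∷ 70 ∷ [])
      ∷ [])
    finalBlock 6 = commonHead ++
      ( times 4 (6 ∷ 7 ∷ 8 ∷ 9 ∷ 6 ∷ 7 ∷ 13 ∷ 8 ∷ 6 ∷ 7 ∷ 9 ∷ 15 ∷ [])
      ∷ (4 ∷ 5 ∷ 16 ∷ 4 ∷ 5 ∷ 18 ∷ 4 ∷ 5 ∷ 25 ∷ 4 ∷ 5 ∷ 16 ∷ 4 ∷ 5 ∷ 26 ∷ 4 ∷ 5 ∷
         18 ∷ 4 ∷ 5 ∷ 16 ∷ 4 ∷ 5 ∷ 25 ∷ 4 ∷ 5 ∷ 28 ∷ 4 ∷ 5 ∷ 16 ∷ 4 ∷ 5 ∷ 18 ∷ 4 ∷
         5 ∷ 26 ∷ 4 ∷ 5 ∷ 16 ∷ 4 ∷ 5 ∷ 25 ∷ 4 ∷ 5 ∷ 28 ∷ 4 ∷ 5 ∷ 29 ∷ [])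
      ∷ times 6 (6 ∷ 7 ∷ 10 ∷ 11 ∷ 6 ∷ 7 ∷ 12 ∷ 14 ∷ [])
      ∷ times 8 (4 ∷ 5 ∷ 8 ∷ 4 ∷ 5 ∷ 9 ∷ [])
      ∷ (6 ∷ 7 ∷ 13 ∷ 15 ∷ 6 ∷ 7 ∷ 17 ∷ 19 ∷ 6 ∷ 7 ∷ 13 ∷ 15 ∷ 6 ∷ 7 ∷ 22 ∷ 17 ∷ 6 ∷
         7 ∷ 13 ∷ 15 ∷ 6 ∷ 7 ∷ 19 ∷ 32 ∷ 6 ∷ 7 ∷ 13 ∷ 15 ∷ 6 ∷ 7 ∷ 17 ∷ 22 ∷ 6 ∷ 7 ∷
         13 ∷ 15 ∷ 6 ∷ 7 ∷ 19 ∷ 17 ∷ 6 ∷ 7 ∷ 13 ∷ 15 ∷ 6 ∷ 7 ∷ 22 ∷ 32 ∷ [])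
      ∷ times 8 (4 ∷ 5 ∷ 10 ∷ 4 ∷ 5 ∷ 11 ∷ [])
      ∷ times 4 (6 ∷ 7 ∷ 8 ∷ 9 ∷ 6 ∷ 7 ∷ 16 ∷ 8 ∷ 6 ∷ 7 ∷ 9 ∷ 18 ∷ [])
      ∷ (4 ∷ 5 ∷ 21 ∷ 4 ∷ 5 ∷ 23 ∷ 4 ∷ 5 ∷ 27 ∷ 4 ∷ 5 ∷ 31 ∷ 4 ∷ 5 ∷ 21 ∷ 4 ∷ 5 ∷
         23 ∷ 4 ∷ 5 ∷ 37 ∷ 4 ∷ 5 ∷ 27 ∷ 4 ∷ 5 ∷ 21 ∷ 4 ∷ 5 ∷ 23 ∷ 4 ∷ 5 ∷ 31 ∷ 4 ∷
         5 ∷ 52 ∷ 4 ∷ 5 ∷ 21 ∷ 4 ∷ 5 ∷ 23 ∷ 4 ∷ 5 ∷ 37 ∷ 4 ∷ 5 ∷ 55 ∷ [])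
      ∷ (6 ∷ 7 ∷ 25 ∷ 34 ∷ 6 ∷ 7 ∷ 35 ∷ 36 ∷ 6 ∷ 7 ∷ 43 ∷ 44 ∷ 6 ∷ 7 ∷ 45 ∷ 25 ∷ 6 ∷
         7 ∷ 47 ∷ 49 ∷ 6 ∷ 7 ∷ 34 ∷ 56 ∷ 6 ∷ 7 ∷ 35 ∷ 36 ∷ 6 ∷ 7 ∷ 25 ∷ 58 ∷ 6 ∷ 7 ∷
         43 ∷ 44 ∷ 6 ∷ 7 ∷ 45 ∷ 60 ∷ 6 ∷ 7 ∷ 47 ∷ 63 ∷ 6 ∷ 7 ∷ 64 ∷ 65 ∷ [])
      ∷ [])
    finalBlock _ = commonHead ++
      ( times 4 (6 ∷ 7 ∷ 8 ∷ 9 ∷ 6 ∷ 7 ∷ 13 ∷ 8 ∷ 6 ∷ 7 ∷ 9 ∷ 15 ∷ [])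
      ∷ (4 ∷ 5 ∷ 16 ∷ 4 ∷ 5 ∷ 18 ∷ 4 ∷ 5 ∷ 25 ∷ 4 ∷ 5 ∷ 16 ∷ 4 ∷ 5 ∷ 26 ∷ 4 ∷ 5 ∷
         18 ∷ 4 ∷ 5 ∷ 16 ∷ 4 ∷ 5 ∷ 25 ∷ 4 ∷ 5 ∷ 28 ∷ 4 ∷ 5 ∷ 16 ∷ 4 ∷ 5 ∷ 18 ∷ 4 ∷
         5 ∷ 26 ∷ 4 ∷ 5 ∷ 16 ∷ 4 ∷ 5 ∷ 25 ∷ 4 ∷ 5 ∷ 28 ∷ 4 ∷ 5 ∷ 29 ∷ [])
      ∷ times 6 (6 ∷ 7 ∷ 10 ∷ 11 ∷ 6 ∷ 7 ∷ 12 ∷ 14 ∷ [])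
      ∷ times 8 (4 ∷ 5 ∷ 8 ∷ 4 ∷ 5 ∷ 9 ∷ [])
      ∷ (6 ∷ 7 ∷ 13 ∷ 15 ∷ 6 ∷ 7 ∷ 17 ∷ 19 ∷ 6 ∷ 7 ∷ 13 ∷ 15 ∷ 6 ∷ 7 ∷ 22 ∷ 17 ∷ 6 ∷
         7 ∷ 13 ∷ 15 ∷ 6 ∷ 7 ∷ 19 ∷ 32 ∷ 6 ∷ 7 ∷ 13 ∷ 15 ∷ 6 ∷ 7 ∷ 17 ∷ 22 ∷ 6 ∷ 7 ∷
         13 ∷ 15 ∷ 6 ∷ 7 ∷ 19 ∷ 17 ∷ 6 ∷ 7 ∷ 13 ∷ 15 ∷ 6 ∷ 7 ∷ 22 ∷ 32 ∷ [])
      ∷ times 8 (4 ∷ 5 ∷ 10 ∷ 4 ∷ 5 ∷ 11 ∷ [])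
      ∷ times 4 (6 ∷ 7 ∷ 8 ∷ 9 ∷ 6 ∷ 7 ∷ 12 ∷ 8 ∷ 6 ∷ 7 ∷ 9 ∷ 14 ∷ [])
      ∷ (4 ∷ 5 ∷ 16 ∷ 4 ∷ 5 ∷ 18 ∷ 4 ∷ 5 ∷ 21 ∷ 4 ∷ 5 ∷ 16 ∷ 4 ∷ 5 ∷ 23 ∷ 4 ∷ 5 ∷
         18 ∷ 4 ∷ 5 ∷ 16 ∷ 4 ∷ 5 ∷ 21 ∷ 4 ∷ 5 ∷ 23 ∷ 4 ∷ 5 ∷ 16 ∷ 4 ∷ 5 ∷ 18 ∷ 4 ∷
         5 ∷ 21 ∷ 4 ∷ 5 ∷ 16 ∷ 4 ∷ 5 ∷ 23 ∷ 4 ∷ 5 ∷ 27 ∷ 4 ∷ 5 ∷ 52 ∷ [])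
      ∷ (6 ∷ 7 ∷ 25 ∷ 31 ∷ 6 ∷ 7 ∷ 33 ∷ 34 ∷ 6 ∷ 7 ∷ 35 ∷ 36 ∷ 6 ∷ 7 ∷ 37 ∷ 25 ∷ 6 ∷
         7 ∷ 38 ∷ 31 ∷ 6 ∷ 7 ∷ 39 ∷ 33 ∷ 6 ∷ 7 ∷ 34 ∷ 40 ∷ 6 ∷ 7 ∷ 25 ∷ 35 ∷ 6 ∷ 7 ∷
         36 ∷ 31 ∷ 6 ∷ 7 ∷ 37 ∷ 38 ∷ 6 ∷ 7 ∷ 39 ∷ 41 ∷ 6 ∷ 7 ∷ 42 ∷ 43 ∷ [])
      ∷ (8 ∷ 9 ∷ 17 ∷ 19 ∷ 29 ∷ 8 ∷ 9 ∷ 44 ∷ 45 ∷ 46 ∷ 8 ∷ 9 ∷ 17 ∷ 19 ∷ 47 ∷ 8 ∷ 9 ∷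
         48 ∷ 49 ∷ 29 ∷ 8 ∷ 9 ∷ 17 ∷ 19 ∷ 50 ∷ 8 ∷ 9 ∷ 51 ∷ 53 ∷ 54 ∷ 8 ∷ 9 ∷ 17 ∷
         19 ∷ 29 ∷ 8 ∷ 9 ∷ 55 ∷ 47 ∷ 56 ∷ 8 ∷ 17 ∷ 9 ∷ 57 ∷ 58 ∷ 59 ∷ 60 ∷ 61 ∷ [])
      ∷ [])

  periodicColumn : ℕ → List ℕ
  periodicColumn = pick periodicWords

  finalColumn : ℕ → ℕ → List ℕ
  finalColumn r = pick (finalBlock r)

  admissible : List ℕ → Bool
  admissible p = (length p ≡ᵇ 48) ∧ WellSpread p ∧ all (λ c → (4 ≤ᵇ c) ∧ (c ≤ᵇ 71)) p

  record Admissible (p : List ℕ) : Set where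
    field
      length≡48   : length p ≡ 48
      well-spread : T (WellSpread p)
      range       : ∀ {c} → T (c ∈ᵇ p) → 4 ≤ c × c ≤ 71

  admissible-sound : ∀ p → T (admissible p) → Admissible p
  admissible-sound p ok with ∧-elim {length p ≡ᵇ 48} ok
  ... | length-ok , rest with ∧-elim {WellSpread p} rest
  ... | spread-ok , range-ok = record
    { length≡48   = ≡ᵇ⇒≡ (length p) 48 length-ok
    ; well-spread = spread-ok
    ; range       = λ {c} c∈p → let (4≤c , c≤71) = ∧-elim (all-sound _ p range-ok c∈p)
                              in ≤ᵇ⇒≤ 4 c 4≤c , ≤ᵇ⇒≤ c 71 c≤71
    }

  module Separation (r : ℕ) (As Fs : List (List ℕ)) where
    L : ℕ
    L = 10 + r
    A F : ℕ → List ℕ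
    A = pick As
    F = pick Fs

    periodicPairs periodicToFinal finalPairs finalToPeriodic finalWrapping : Bool
    -- periodic column i to periodic column i + d (word (i + d) mod 8), 1 ≤ d ≤ 17
    periodicPairs = all< 8 (λ i → all< 17 (λ d → separated (4 * suc d) (A i) (A ((i + suc d) % 8))))
    -- periodic column i to final column q, without wrapping
    periodicToFinal = all< 8 (λ i → all< L (λ q → separated (4 * (8 ∸ i + q)) (A i) (F q)))
    -- final column q to a later final column q'
    finalPairs = all< L (λ q → all< L (λ q' → not (q <ᵇ q') ∨ separated (4 * (q' ∸ q)) (F q) (F q')))
    -- final column q to periodic column i, wrapping around
    finalToPeriodic = all< L (λ q → all< 8 (λ i → separated (4 * (L ∸ q + i)) (F q) (A i)))
    -- final column q to final column q', wrapping around through the periodic region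
    finalWrapping = all< L (λ q → all< L (λ q' → separated (4 * (L ∸ q + 8 + q')) (F q) (F q')))

  -- The palettes are computed once per residue and shared by all tests of that residue.
  periodicPalettes : List (List ℕ)
  periodicPalettes = map palette periodicWords

  finalPalettes : ℕ → List (List ℕ)
  finalPalettes r = map palette (finalBlock r)

  -- The certificate, checked by evaluation for each residue r < 8.
  opaque
    unfolding periodicWords commonHead finalBlock

    periodic-admissible : T (all< 8 (λ i → admissible (periodicColumn i)))
    periodic-admissible = _

    final-admissible : T (all< 8 (λ r → all< (10 + r) (λ q → admissible (finalColumn r q))))
    final-admissible = _

    periodic-pairs-certified : T (all< 8 (λ r → Separation.periodicPairs r periodicPalettes (finalPalettes r)))
    periodic-pairs-certified = _

    periodic-to-final-certified : T (all< 8 (λ r → Separation.periodicToFinal r periodicPalettes (finalPalettes r)))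
    periodic-to-final-certified = _

    final-pairs-certified : T (all< 8 (λ r → Separation.finalPairs r periodicPalettes (finalPalettes r)))
    final-pairs-certified = _

    final-to-periodic-certified : T (all< 8 (λ r → Separation.finalToPeriodic r periodicPalettes (finalPalettes r)))
    final-to-periodic-certified = _

    final-wrapping-certified : T (all< 8 (λ r → Separation.finalWrapping r periodicPalettes (finalPalettes r)))
    final-wrapping-certified = _

-- The cycle of N = 18 + N' columns used on lane 3: a periodic region of P = 8 (b + 1)
-- columns carrying the periodic words, followed by the final block for r = N' mod 8.
module ColumnCycle (N' : ℕ) where
  open import Data.Nat using (zero; suc; _+_; _*_; _∸_; _<_; _/_; _<?_; _<ᵇ_; s≤s; s≤s⁻¹)
  open import Data.Nat.Properties
  open import Data.Nat.DivMod using (m%n<n; m≡m%n+[m/n]*n; [m+n]%n≡m%n; [m+kn]%n≡m%n; m<n⇒m%n≡m; m<n*o⇒m/o<n)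
  open import Data.Nat.Tactic.RingSolver using (solve-∀)
  open import Data.List using (map)
  open FiniteChecks
  open ColumnWords

  N r b L P : ℕ
  N = 18 + N'
  r = N' % 8
  b = N' / 8
  L = 10 + r
  P = 8 + b * 8

  N≡P+L : N ≡ P + L
  N≡P+L = trans (cong (18 +_) (m≡m%n+[m/n]*n N' 8)) (identity r b)
    where
    identity : ∀ r b → 18 + (r + b * 8) ≡ 8 + b * 8 + (10 + r)
    identity = solve-∀

  column : ℕ → List ℕ
  column w = if w <ᵇ P then periodicColumn (w % 8) else finalColumn r (w ∸ P)

  data Region (w : ℕ) : Set where
    periodic : ∀ i j → i < 8 → j ≤ b → w ≡ i + j * 8 → column w ≡ periodicColumn i → Region w
    final    : ∀ q → q < L → w ≡ P + q → column w ≡ finalColumn r q → Region w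

  region : ∀ {w} → w < N → Region w
  region {w} w<N with w <? P
  ... | yes w<P = periodic (w % 8) (w / 8) (m%n<n w 8) (s≤s⁻¹ (m<n*o⇒m/o<n {w} {suc b} w<P))
                    (m≡m%n+[m/n]*n w 8) (if-yes (<⇒<ᵇ w<P))
  ... | no w≮P  = final (w ∸ P) q<L (sym (m+[n∸m]≡n P≤w)) (if-no (λ w<ᵇP → w≮P (<ᵇ⇒< w P w<ᵇP)))
    where
    P≤w : P ≤ w
    P≤w = ≮⇒≥ w≮P
    q<L : w ∸ P < L
    q<L = +-cancelˡ-< P _ _ (subst₂ _<_ (sym (m+[n∸m]≡n P≤w)) N≡P+L w<N)

  r<8 : r < 8
  r<8 = m%n<n N' 8

  private
    module S = Separation r periodicPalettes (finalPalettes r)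

    at-r : (test : ℕ → List (List ℕ) → List (List ℕ) → Bool) →
           T (all< 8 (λ r → test r periodicPalettes (finalPalettes r))) → T (test r periodicPalettes (finalPalettes r))
    at-r test certified = all<-sound 8 (λ r → test r periodicPalettes (finalPalettes r)) certified r<8

    pick-palette : ∀ ws i → pick (map palette ws) i ≡ palette (pick ws i)
    pick-palette []       i       = refl
    pick-palette (w ∷ ws) zero    = refl
    pick-palette (w ∷ ws) (suc i) = pick-palette ws i

    apart-sound : ∀ {X d c} As Fs i j → T (separated (4 * X) (pick (map palette As) i) (pick (map palette Fs) j)) →
                  X ≤ d → T (c ∈ᵇ pick As i) → T (c ∈ᵇ pick Fs j) → c < 4 * d
    apart-sound {X} {d} As Fs i j test X≤d c∈p c∈p' =
      <-≤-trans (separated-sound (4 * X) (palette (pick As i)) (palette (pick Fs j)) test′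
                  (palette-⊇ (pick As i) c∈p) (palette-⊇ (pick Fs j) c∈p'))
                (*-monoʳ-≤ 4 X≤d)
      where
      test′ : T (separated (4 * X) (palette (pick As i)) (palette (pick Fs j)))
      test′ = subst₂ (λ S S' → T (separated (4 * X) S S')) (pick-palette As i) (pick-palette Fs j) test

  admissible-column : ∀ {w} → w < N → Admissible (column w)
  admissible-column {w} w<N = admissible-sound (column w) (column-admissible (region w<N))
    where
    column-admissible : Region w → T (admissible (column w))
    column-admissible (periodic i _ i<8 _ _ col) = subst (T ∘ admissible) (sym col)
          (all<-sound 8 (λ i → admissible (periodicColumn i)) periodic-admissible i<8)
    column-admissible (final q q<L _ col) = subst (T ∘ admissible) (sym col)
          (all<-sound L (λ q → admissible (finalColumn r q))
            (all<-sound 8 (λ r → all< (10 + r) (λ q → admissible (finalColumn r q))) final-admissible r<8) q<L)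

  periodic-pair : ∀ {i d c} → i < 8 → 0 < d → d < 18 → T (c ∈ᵇ periodicColumn i) →
                  T (c ∈ᵇ periodicColumn ((i + d) % 8)) → c < 4 * d
  periodic-pair {i} {suc d} i<8 _ d<18 =
    apart-sound {suc d} periodicWords periodicWords i ((i + suc d) % 8)
      (all<²-sound 8 17 (λ i d → separated (4 * suc d) (S.A i) (S.A ((i + suc d) % 8)))
                   (at-r Separation.periodicPairs periodic-pairs-certified) i<8 (s≤s⁻¹ d<18))
      ≤-refl

  periodic-to-final : ∀ {i q d c} → i < 8 → q < L → 8 ∸ i + q ≤ d → T (c ∈ᵇ periodicColumn i) →
                      T (c ∈ᵇ finalColumn r q) → c < 4 * d
  periodic-to-final {i} {q} i<8 q<L =
    apart-sound {8 ∸ i + q} periodicWords (finalBlock r) i q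
      (all<²-sound 8 L (λ i q → separated (4 * (8 ∸ i + q)) (S.A i) (S.F q))
                   (at-r Separation.periodicToFinal periodic-to-final-certified) i<8 q<L)

  final-pair : ∀ {q q' d c} → q < q' → q' < L → q' ∸ q ≤ d → T (c ∈ᵇ finalColumn r q) →
               T (c ∈ᵇ finalColumn r q') → c < 4 * d
  final-pair {q} {q'} q<q' q'<L with ∨-elim (all<²-sound L L
      (λ q q' → not (q <ᵇ q') ∨ separated (4 * (q' ∸ q)) (S.F q) (S.F q'))
      (at-r Separation.finalPairs final-pairs-certified) (<-trans q<q' q'<L) q'<L)
  ... | inj₁ q≮q' = ⊥-elim (not-T (<⇒<ᵇ q<q') q≮q')
  ... | inj₂ test = apart-sound {q' ∸ q} (finalBlock r) (finalBlock r) q q' test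

  final-to-periodic : ∀ {q i d c} → q < L → i < 8 → L ∸ q + i ≤ d → T (c ∈ᵇ finalColumn r q) →
                      T (c ∈ᵇ periodicColumn i) → c < 4 * d
  final-to-periodic {q} {i} q<L i<8 =
    apart-sound {L ∸ q + i} (finalBlock r) periodicWords q i
      (all<²-sound L 8 (λ q i → separated (4 * (L ∸ q + i)) (S.F q) (S.A i))
                   (at-r Separation.finalToPeriodic final-to-periodic-certified) q<L i<8)

  final-wrapping : ∀ {q q' d c} → q < L → q' < L → L ∸ q + 8 + q' ≤ d → T (c ∈ᵇ finalColumn r q) →
                   T (c ∈ᵇ finalColumn r q') → c < 4 * d
  final-wrapping {q} {q'} q<L q'<L =
    apart-sound {L ∸ q + 8 + q'} (finalBlock r) (finalBlock r) q q'
      (all<²-sound L L (λ q q' → separated (4 * (L ∸ q + 8 + q')) (S.F q) (S.F q'))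
                   (at-r Separation.finalWrapping final-wrapping-certified) q<L q'<L)

  periodic-room : ∀ {i j} → i < 8 → j ≤ b → 8 ∸ i + (i + j * 8) ≤ P
  periodic-room {i} {j} i<8 j≤b = begin
    8 ∸ i + (i + j * 8) ≡⟨ sym (+-assoc (8 ∸ i) i (j * 8)) ⟩
    8 ∸ i + i + j * 8   ≡⟨ cong (_+ j * 8) (m∸n+n≡m (<⇒≤ i<8)) ⟩
    8 + j * 8           ≤⟨ +-monoʳ-≤ 8 (*-monoˡ-≤ 8 j≤b) ⟩
    P                   ∎
    where open ≤-Reasoning

  periodic<P : ∀ {i j} → i < 8 → j ≤ b → i + j * 8 < P
  periodic<P {i} i<8 j≤b = <-≤-trans (m<n+m _ (m<n⇒0<n∸m i<8)) (periodic-room i<8 j≤b)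

  periodic-shift : ∀ {i j i' j' d} → i' < 8 → i' + j' * 8 ≡ i + j * 8 + d → i' ≡ (i + d) % 8
  periodic-shift {i} {j} {i'} {j'} {d} i'<8 e = begin
    i'                  ≡⟨ sym (m<n⇒m%n≡m i'<8) ⟩
    i' % 8              ≡⟨ sym ([m+kn]%n≡m%n i' j' 8) ⟩
    (i' + j' * 8) % 8   ≡⟨ cong (_% 8) (trans e (identity i (j * 8) d)) ⟩
    (i + d + j * 8) % 8 ≡⟨ [m+kn]%n≡m%n (i + d) j 8 ⟩
    (i + d) % 8         ∎
    where
    open ≡-Reasoning
    identity : ∀ a b c → a + b + c ≡ a + c + b
    identity = solve-∀

  periodic-to-final-distance : ∀ {i j q' d} → i < 8 → j ≤ b → P + q' ≡ i + j * 8 + d → 8 ∸ i + q' ≤ d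
  periodic-to-final-distance {i} {j} {q'} {d} i<8 j≤b e = +-cancelʳ-≤ (i + j * 8) _ _ (begin
    8 ∸ i + q' + (i + j * 8)   ≡⟨ identity (8 ∸ i) q' (i + j * 8) ⟩
    8 ∸ i + (i + j * 8) + q'   ≤⟨ +-monoˡ-≤ q' (periodic-room i<8 j≤b) ⟩
    P + q'                     ≡⟨ trans e (+-comm (i + j * 8) d) ⟩
    d + (i + j * 8)            ∎)
    where
    open ≤-Reasoning
    identity : ∀ x q w → x + q + w ≡ x + w + q
    identity = solve-∀

  periodic-wrap-distance : ∀ {i j i' j' d} → i < 8 → j ≤ b → i' + j' * 8 + N ≡ i + j * 8 + d →
                           8 ∸ i + i' ≤ d
  periodic-wrap-distance {i} {j} {i'} {j'} {d} i<8 j≤b e = +-cancelʳ-≤ (i + j * 8) _ _ (begin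
    8 ∸ i + i' + (i + j * 8)   ≡⟨ identity (8 ∸ i) i' (i + j * 8) ⟩
    8 ∸ i + (i + j * 8) + i'   ≤⟨ +-mono-≤ (periodic-room i<8 j≤b) (m≤m+n i' (j' * 8)) ⟩
    P + (i' + j' * 8)          ≤⟨ m≤m+n _ L ⟩
    P + (i' + j' * 8) + L      ≡⟨ identity′ P (i' + j' * 8) L ⟩
    i' + j' * 8 + (P + L)      ≡⟨ cong (i' + j' * 8 +_) (sym N≡P+L) ⟩
    i' + j' * 8 + N            ≡⟨ trans e (+-comm (i + j * 8) d) ⟩
    d + (i + j * 8)            ∎)
    where
    open ≤-Reasoning
    identity : ∀ x q w → x + q + w ≡ x + w + q
    identity = solve-∀
    identity′ : ∀ a b c → a + b + c ≡ b + (a + c)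
    identity′ = solve-∀

  final-to-periodic-distance : ∀ {q i' j' d} → q < L → i' + j' * 8 + N ≡ P + q + d → L ∸ q + i' ≤ d
  final-to-periodic-distance {q} {i'} {j'} {d} q<L e = +-cancelʳ-≤ (P + q) _ _ (begin
    L ∸ q + i' + (P + q)       ≡⟨ identity (L ∸ q) i' P q ⟩
    L ∸ q + q + (P + i')       ≡⟨ cong (_+ (P + i')) (m∸n+n≡m (<⇒≤ q<L)) ⟩
    L + (P + i')               ≤⟨ +-monoʳ-≤ L (+-monoʳ-≤ P (m≤m+n i' (j' * 8))) ⟩
    L + (P + (i' + j' * 8))    ≡⟨ identity′ L P (i' + j' * 8) ⟩
    i' + j' * 8 + (P + L)      ≡⟨ cong (i' + j' * 8 +_) (sym N≡P+L) ⟩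
    i' + j' * 8 + N            ≡⟨ trans e (+-comm (P + q) d) ⟩
    d + (P + q)                ∎)
    where
    open ≤-Reasoning
    identity : ∀ x i P q → x + i + (P + q) ≡ x + q + (P + i)
    identity = solve-∀
    identity′ : ∀ L P w → L + (P + w) ≡ w + (P + L)
    identity′ = solve-∀

  final-wrap-distance : ∀ {q q' d} → q < L → P + q' + N ≡ P + q + d → L ∸ q + 8 + q' ≤ d
  final-wrap-distance {q} {q'} {d} q<L e = +-cancelʳ-≤ (P + q) _ _ (begin
    L ∸ q + 8 + q' + (P + q)   ≡⟨ identity (L ∸ q) q' P q ⟩
    L ∸ q + q + (8 + (P + q')) ≡⟨ cong (_+ (8 + (P + q'))) (m∸n+n≡m (<⇒≤ q<L)) ⟩
    L + (8 + (P + q'))         ≤⟨ +-monoʳ-≤ L (+-monoˡ-≤ (P + q') (m≤m+n 8 (b * 8))) ⟩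
    L + (P + (P + q'))         ≡⟨ identity′ L P (P + q') ⟩
    P + q' + (P + L)           ≡⟨ cong (P + q' +_) (sym N≡P+L) ⟩
    P + q' + N                 ≡⟨ trans e (+-comm (P + q) d) ⟩
    d + (P + q)                ∎)
    where
    open ≤-Reasoning
    identity : ∀ x q' P q → x + 8 + q' + (P + q) ≡ x + q + (8 + (P + q'))
    identity = solve-∀
    identity′ : ∀ L P w → L + (P + w) ≡ w + (P + L)
    identity′ = solve-∀

  nearby-columns : ∀ {w w' d c} → 0 < d → d < 18 → Region w → Region w' → Ahead N w w' d →
                   T (c ∈ᵇ column w) → T (c ∈ᵇ column w') → c < 4 * d
  nearby-columns {d = d} {c} d>0 d<18
                 (periodic i j i<8 j≤b refl col) (periodic i' j' i'<8 j'≤b refl col') (inj₁ e) c∈ c∈' =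
    periodic-pair i<8 d>0 d<18 (member col c∈)
      (subst (λ k → T (c ∈ᵇ periodicColumn k)) (periodic-shift {i} {j} {i'} {j'} i'<8 e) (member col' c∈'))
  nearby-columns d>0 d<18 (periodic i j i<8 j≤b refl col) (final q' q'<L refl col') (inj₁ e) c∈ c∈' =
    periodic-to-final i<8 q'<L (periodic-to-final-distance i<8 j≤b e) (member col c∈) (member col' c∈')
  nearby-columns d>0 d<18 (final q q<L refl col) (periodic i' j' i'<8 j'≤b refl col') (inj₁ e) c∈ c∈' =
    ⊥-elim (<⇒≱ (periodic<P i'<8 j'≤b) (subst (P ≤_) (sym e) (≤-trans (m≤m+n P q) (m≤m+n (P + q) _))))
  nearby-columns {d = d} d>0 d<18 (final q q<L refl col) (final q' q'<L refl col') (inj₁ e) c∈ c∈' =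
    final-pair (subst (q <_) (sym q'≡q+d) (m<m+n q d>0)) q'<L
      (≤-reflexive (trans (cong (_∸ q) q'≡q+d) (m+n∸m≡n q d))) (member col c∈) (member col' c∈')
    where
    q'≡q+d : q' ≡ q + d
    q'≡q+d = +-cancelˡ-≡ P _ _ (trans e (+-assoc P q d))
  nearby-columns {d = d} {c} d>0 d<18
                 (periodic i j i<8 j≤b refl col) (periodic i' j' i'<8 j'≤b refl col') (inj₂ e) c∈ c∈' =
    <-≤-trans (periodic-pair {i} {X} i<8 X>0 X<18 (member col c∈)
                (subst (λ k → T (c ∈ᵇ periodicColumn k)) (sym i'≡) (member col' c∈')))
              (*-monoʳ-≤ 4 (periodic-wrap-distance {i} {j} {i'} {j'} i<8 j≤b e))
    where
    X : ℕ
    X = 8 ∸ i + i'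
    X>0 : 0 < X
    X>0 = <-≤-trans (m<n⇒0<n∸m i<8) (m≤m+n (8 ∸ i) i')
    X<18 : X < 18
    X<18 = +-mono-≤-< (m∸n≤m 8 i) (<-≤-trans i'<8 (m≤m+n 8 2))
    i'≡ : (i + X) % 8 ≡ i'
    i'≡ = begin
      (i + (8 ∸ i + i')) % 8 ≡⟨ cong (_% 8) (trans (sym (+-assoc i (8 ∸ i) i')) (cong (_+ i') (m+[n∸m]≡n (<⇒≤ i<8)))) ⟩
      (8 + i') % 8           ≡⟨ cong (_% 8) (+-comm 8 i') ⟩
      (i' + 8) % 8           ≡⟨ [m+n]%n≡m%n i' 8 ⟩
      i' % 8                 ≡⟨ m<n⇒m%n≡m i'<8 ⟩
      i'                     ∎
      where open ≡-Reasoning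
  nearby-columns {d = d} d>0 d<18 (periodic i j i<8 j≤b refl col) (final q' q'<L refl col') (inj₂ e) c∈ c∈' =
    ⊥-elim (<⇒≱ (+-mono-< (periodic<P i<8 j≤b) d<18) (subst (P + 18 ≤_) e (+-mono-≤ (m≤m+n P q') (m≤m+n 18 N'))))
  nearby-columns d>0 d<18 (final q q<L refl col) (periodic i' j' i'<8 j'≤b refl col') (inj₂ e) c∈ c∈' =
    final-to-periodic q<L i'<8 (final-to-periodic-distance {q} {i'} {j'} q<L e) (member col c∈) (member col' c∈')
  nearby-columns d>0 d<18 (final q q<L refl col) (final q' q'<L refl col') (inj₂ e) c∈ c∈' =
    final-wrapping q<L q'<L (final-wrap-distance q<L e) (member col c∈) (member col' c∈')

  across-columns : ∀ {w w' d c} → w < N → w' < N → 0 < d → Ahead N w w' d →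
                   T (c ∈ᵇ column w) → T (c ∈ᵇ column w') → c ≤ 71 → c < 4 * d
  across-columns {d = d} w<N w'<N d>0 ahead c∈ c∈' c≤71 with d <? 18
  ... | yes d<18 = nearby-columns d>0 d<18 (region w<N) (region w'<N) ahead c∈ c∈'
  ... | no d≮18  = ≤-trans (s≤s c≤71) (*-monoʳ-≤ 4 (≮⇒≥ d≮18))

module Parity where
  open import Data.Integer hiding (_≤_; _<_; _%_)
  open import Data.Integer.Properties using (abs-*)
  open import Data.Integer.Tactic.RingSolver using (solve-∀)
  open import Data.Nat.DivMod using (m*n%n≡0)
  import Data.Nat as ℕ
  import Data.Nat.Properties as ℕP

  evens-nonadjacent : ∀ {t} → t % 2 ≡ 1 → ∀ a b → ¬ Adj (OneT t) (+ 2 * a) (+ 2 * b)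
  evens-nonadjacent {t} t-odd a b adj = odd-even (∣ a - b ∣) (subst (OneT t) distance adj)
    where
    distance : ∣ + 2 * a - + 2 * b ∣ ≡ 2 ℕ.* ∣ a - b ∣
    distance = trans (cong ∣_∣ (identity a b)) (abs-* (+ 2) (a - b))
      where
      identity : ∀ a b → + 2 * a - + 2 * b ≡ + 2 * (a - b)
      identity = solve-∀
    even : ∀ m → (2 ℕ.* m) % 2 ≡ 0
    even m = trans (cong (_% 2) (ℕP.*-comm 2 m)) (m*n%n≡0 m 2)
    odd-even : ∀ m → ¬ OneT t (2 ℕ.* m)
    odd-even m (inj₁ 2m≡1) = 0≢1 (trans (sym (even m)) (cong (_% 2) 2m≡1))
      where 0≢1 : 0 ≢ 1
            0≢1 ()
    odd-even m (inj₂ 2m≡t) = 0≢1 (trans (sym (even m)) (trans (cong (_% 2) 2m≡t) t-odd))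
      where 0≢1 : 0 ≢ 1
            0≢1 ()

  Even : ℤ → Set
  Even x = Σ ℤ λ a → x ≡ + 2 * a

  evens-apart : ∀ {t u v n} → t % 2 ≡ 1 → Even u → Even v → u ≢ v → n ≤ 1 → ¬ Walk (OneT t) u v n
  evens-apart _     _         _         u≢v _ here                 = u≢v refl
  evens-apart t-odd (a , refl) (b , refl) _ _ (step adj here)      = evens-nonadjacent t-odd a b adj
  evens-apart _     _         _         _ (ℕ.s≤s ()) (step _ (step _ _))

module Colouring (t N' : ℕ) (σ : ℤ.ℤ) (t≡4N+σ : ℤ.+ t ≡ ℤ.+ 4 ℤ.* ℤ.+ ColumnCycle.N N' ℤ.+ σ)
                 (∣σ∣≡1 : ℤ.∣ σ ∣ ≡ 1) (t-odd : t % 2 ≡ 1) where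
  open import Data.Integer hiding (_≤_; _<_; _%_; _/_)
  open import Data.Integer.Properties using (pos-*)
  open import Data.Integer.DivMod using (_%ℕ_; _/ℕ_; n%ℕd<d; a≡a%ℕn+[a/ℕn]*n)
  open import Data.Integer.Tactic.RingSolver using (solve-∀)
  open import Data.Nat using (_<_; _/_; z≤n; s≤s; s≤s⁻¹)
  import Data.Nat as ℕ
  import Data.Nat.Properties as ℕP
  open import Data.Nat.DivMod using (m%n<n; m≡m%n+[m/n]*n)
  open import Data.Fin using (Fin; toℕ; fromℕ<)
  open import Data.Fin.Properties using (toℕ-fromℕ<)
  open FiniteChecks
  open ColumnWords using (Admissible)
  open ColumnCycle N' using (N; column; admissible-column; across-columns)
  open LaneGeometry t N σ t≡4N+σ ∣σ∣≡1
  open Parity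

  alternating : List ℕ
  alternating = 2 ∷ 3 ∷ []

  alternating≤3 : ∀ k → entry alternating k ≤ 3
  alternating≤3 0 = s≤s (s≤s z≤n)
  alternating≤3 1 = ℕP.≤-refl
  alternating≤3 (ℕ.suc (ℕ.suc k)) = z≤n

  -- The word 2 3 is well spread (checked by evaluation), and colours ≤ 3 are below 4d.
  middle-lane : LanePattern 2
  middle-lane = record
    { colour         = λ _ k → entry alternating k
    ; along-column   = λ _ → well-spread-sound alternating _
    ; across-columns = λ {_} {_} {k} _ _ _ _ d>0 _ _ → ℕP.≤-trans (s≤s (alternating≤3 k)) (ℕP.*-monoʳ-≤ 4 d>0)
    }

  dense-lane : LanePattern 48
  dense-lane = record
    { colour         = λ w k → entry (column w) k
    ; along-column   = within-column
    ; across-columns = between-columns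
    }
    where
    within-column : ∀ {w k k' d} → w < N → k < 48 → k' < 48 → 0 < d → d < 48 → Ahead 48 k k' d →
                    entry (column w) k ≡ entry (column w) k' → entry (column w) k < 2 ℕ.* d
    within-column {w} {k} {k'} {d} w<N k<48 k'<48 d>0 d<48 ahead same =
      well-spread-sound (column w) well-spread (at k<48) (at k'<48) d>0 (at d<48)
                        (subst (λ m → Ahead m k k' d) (sym length≡48) ahead) same
      where
      open Admissible (admissible-column w<N)
      at : ∀ {i} → i < 48 → i < length (column w)
      at = subst (_ <_) (sym length≡48)
    between-columns : ∀ {w w' k k' d} → w < N → w' < N → k < 48 → k' < 48 → 0 < d → Ahead N w w' d →
                      entry (column w) k ≡ entry (column w') k' → entry (column w) k < 4 ℕ.* d
    between-columns {w} {w'} {k} {k'} w<N w'<N k<48 k'<48 d>0 ahead same =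
      across-columns w<N w'<N d>0 ahead c∈w c∈w' (proj₂ (Admissible.range (admissible-column w<N) c∈w))
      where
      c∈w : T (entry (column w) k ∈ᵇ column w)
      c∈w = entry-∈ (column w) (subst (k <_) (sym (Admissible.length≡48 (admissible-column w<N))) k<48)
      c∈w' : T (entry (column w) k ∈ᵇ column w')
      c∈w' = subst (λ c → T (c ∈ᵇ column w')) (sym same)
               (entry-∈ (column w') (subst (k' <_) (sym (Admissible.length≡48 (admissible-column w'<N))) k'<48))

  laneColour : ℕ → ℕ → ℤ → ℕ
  laneColour 1 w Q = LanePattern.colour middle-lane w (Q %ℕ 2)
  laneColour 3 w Q = LanePattern.colour dense-lane w (Q %ℕ 48)
  laneColour _ _ _ = 1

  lane column-of : ℤ → ℕ
  lane x = (x %ℕ (4 ℕ.* N)) ℕ.% 4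
  column-of x = (x %ℕ (4 ℕ.* N)) / 4
  row : ℤ → ℤ
  row x = x /ℕ (4 ℕ.* N)

  lane<4 : ∀ x → lane x < 4
  lane<4 x = m%n<n (x %ℕ (4 ℕ.* N)) 4

  column<N : ∀ x → column-of x < N
  column<N x = ℕP.*-cancelʳ-< 4 (column-of x) N (begin-strict
    column-of x ℕ.* 4             ≤⟨ ℕP.m≤n+m _ (lane x) ⟩
    lane x ℕ.+ column-of x ℕ.* 4  ≡⟨ sym (m≡m%n+[m/n]*n (x %ℕ (4 ℕ.* N)) 4) ⟩
    x %ℕ (4 ℕ.* N)                <⟨ n%ℕd<d x (4 ℕ.* N) ⟩
    4 ℕ.* N                       ≡⟨ ℕP.*-comm 4 N ⟩
    N ℕ.* 4                       ∎)
    where open ℕP.≤-Reasoning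

  decompose : ∀ x → x ≡ position (lane x) (column-of x) (row x)
  decompose x = begin
    x                                             ≡⟨ a≡a%ℕn+[a/ℕn]*n x (4 ℕ.* N) ⟩
    + R + row x * + (4 ℕ.* N)                     ≡⟨ cong (λ r → + r + row x * + (4 ℕ.* N)) (m≡m%n+[m/n]*n R 4) ⟩
    + (lane x ℕ.+ column-of x ℕ.* 4) + row x * + (4 ℕ.* N)
                                                  ≡⟨ cong₂ (λ a b → a + row x * b) (pos-+* (lane x) (column-of x) 4) (pos-* 4 N) ⟩
    + lane x + + column-of x * + 4 + row x * (+ 4 * + N) ≡⟨ identity (+ lane x) (+ column-of x) (row x) (+ N) ⟩
    position (lane x) (column-of x) (row x)       ∎
    where
    open ≡-Reasoning
    open CyclicOffsets using (pos-+*)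
    R : ℕ
    R = x %ℕ (4 ℕ.* N)
    identity : ∀ ℓ w Q N → ℓ + w * + 4 + Q * (+ 4 * N) ≡ ℓ + + 4 * (w + Q * N)
    identity = solve-∀

  colour : ℤ → ℕ
  colour x = laneColour (lane x) (column-of x) (row x)

  -- The three kinds of lane, recognisable from the colours they use.
  data Kind : Set where
    sparse middle dense : Kind

  laneKind : ℕ → Kind
  laneKind 1 = middle
  laneKind 3 = dense
  laneKind _ = sparse

  colourKind : ℕ → Kind
  colourKind 0 = sparse
  colourKind 1 = sparse
  colourKind 2 = middle
  colourKind 3 = middle
  colourKind _ = dense

  lane-colour : ∀ ℓ w Q → w < N →
                1 ≤ laneColour ℓ w Q × laneColour ℓ w Q ≤ 71 × colourKind (laneColour ℓ w Q) ≡ laneKind ℓ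
  lane-colour 0 w Q _ = s≤s z≤n , s≤s z≤n , refl
  lane-colour 1 w Q _ with Q %ℕ 2 | n%ℕd<d Q 2
  ... | 0 | _ = s≤s z≤n , s≤s (s≤s z≤n) , refl
  ... | 1 | _ = s≤s z≤n , s≤s (s≤s (s≤s z≤n)) , refl
  ... | ℕ.suc (ℕ.suc _) | s≤s (s≤s ())
  lane-colour 2 w Q _ = s≤s z≤n , s≤s z≤n , refl
  lane-colour 3 w Q w<N with entry (column w) (Q %ℕ 48) | range (entry-∈ (column w) k<length)
    where
    open Admissible (admissible-column w<N)
    k<length : Q %ℕ 48 < length (column w)
    k<length = subst (Q %ℕ 48 <_) (sym length≡48) (n%ℕd<d Q 48)
  ... | c | (s≤s (s≤s (s≤s (s≤s _))) , c≤71) = s≤s z≤n , c≤71 , refl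
  lane-colour (ℕ.suc (ℕ.suc (ℕ.suc (ℕ.suc ℓ)))) w Q _ = s≤s z≤n , s≤s z≤n , refl

  data EvenLane : ℕ → Set where
    lane₀ : EvenLane 0
    lane₂ : EvenLane 2

  data SameKind : ℕ → ℕ → Set where
    sparse : ∀ {ℓ ℓ'} → EvenLane ℓ → EvenLane ℓ' → SameKind ℓ ℓ'
    middle : SameKind 1 1
    dense  : SameKind 3 3

  same-kind : ∀ ℓ ℓ' → ℓ < 4 → ℓ' < 4 → laneKind ℓ ≡ laneKind ℓ' → SameKind ℓ ℓ'
  same-kind 0 0 _ _ _  = sparse lane₀ lane₀
  same-kind 0 2 _ _ _  = sparse lane₀ lane₂
  same-kind 2 0 _ _ _  = sparse lane₂ lane₀
  same-kind 2 2 _ _ _  = sparse lane₂ lane₂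
  same-kind 1 1 _ _ _  = middle
  same-kind 3 3 _ _ _  = dense
  same-kind 0 1 _ _ ()
  same-kind 0 3 _ _ ()
  same-kind 1 0 _ _ ()
  same-kind 1 2 _ _ ()
  same-kind 1 3 _ _ ()
  same-kind 2 1 _ _ ()
  same-kind 2 3 _ _ ()
  same-kind 3 0 _ _ ()
  same-kind 3 1 _ _ ()
  same-kind 3 2 _ _ ()
  same-kind (ℕ.suc (ℕ.suc (ℕ.suc (ℕ.suc _)))) _ (s≤s (s≤s (s≤s (s≤s ())))) _ _
  same-kind _ (ℕ.suc (ℕ.suc (ℕ.suc (ℕ.suc _)))) _ (s≤s (s≤s (s≤s (s≤s ())))) _

  even-position : ∀ {ℓ} w Q → EvenLane ℓ → Even (position ℓ w Q)
  even-position w Q lane₀ = + 2 * (+ w + Q * + N) , identity₀ (+ w + Q * + N)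
    where
    identity₀ : ∀ z → + 0 + + 4 * z ≡ + 2 * (+ 2 * z)
    identity₀ = solve-∀
  even-position w Q lane₂ = + 1 + + 2 * (+ w + Q * + N) , identity₂ (+ w + Q * + N)
    where
    identity₂ : ∀ z → + 2 + + 4 * z ≡ + 2 * (+ 1 + + 2 * z)
    identity₂ = solve-∀

  apart : ∀ {ℓ ℓ' w w' Q Q' n} → w < N → w' < N → SameKind ℓ ℓ' →
          position ℓ w Q ≢ position ℓ' w' Q' → laneColour ℓ w Q ≡ laneColour ℓ' w' Q' →
          n ≤ laneColour ℓ w Q → ¬ Walk (OneT t) (position ℓ w Q) (position ℓ' w' Q') n
  apart {w = w} {w'} {Q} {Q'} _ _ (sparse e e') u≢v _ n≤c =
    evens-apart t-odd (even-position w Q e) (even-position w' Q' e') u≢v (ℕP.≤-trans n≤c (colour-1 e))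
    where
    colour-1 : ∀ {ℓ} → EvenLane ℓ → laneColour ℓ w Q ≤ 1
    colour-1 lane₀ = ℕP.≤-refl
    colour-1 lane₂ = ℕP.≤-refl
  apart {w = w} {w'} {Q} {Q'} w<N w'<N middle u≢v same n≤c =
    lane-packing middle-lane {1} {w} {w'} {Q} {Q'} w<N w'<N u≢v same c<4N (s≤s c≤3) n≤c
    where
    c≤3 : laneColour 1 w Q ≤ 3
    c≤3 = alternating≤3 (Q %ℕ 2)
    c<4N : laneColour 1 w Q < 4 ℕ.* N
    c<4N = ℕP.≤-trans (s≤s c≤3) (ℕP.*-monoʳ-≤ 4 {1} {N} (s≤s z≤n))
  apart {w = w} {w'} {Q} {Q'} w<N w'<N dense u≢v same n≤c =
    lane-packing dense-lane {3} {w} {w'} {Q} {Q'} w<N w'<N u≢v same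
      (ℕP.≤-trans c<72 (ℕP.*-monoʳ-≤ 4 (ℕP.m≤m+n 18 N'))) (ℕP.≤-trans c<72 (ℕP.m≤m+n 72 24)) n≤c
    where
    c<72 : laneColour 3 w Q < 72
    c<72 = s≤s (proj₁ (proj₂ (lane-colour 3 w Q w<N)))

  f : ℤ → Fin 86
  f x = fromℕ< (ℕP.≤-<-trans (ℕP.m∸n≤m (colour x) 1) (s≤s (ℕP.≤-trans c≤71 (ℕP.m≤m+n 71 14))))
    where
    c≤71 : colour x ≤ 71
    c≤71 = proj₁ (proj₂ (lane-colour (lane x) (column-of x) (row x) (column<N x)))

  suc-f : ∀ x → ℕ.suc (toℕ (f x)) ≡ colour x
  suc-f x = trans (cong ℕ.suc (toℕ-fromℕ< _)) (ℕP.m+[n∸m]≡n 1≤c)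
    where
    1≤c : 1 ≤ colour x
    1≤c = proj₁ (lane-colour (lane x) (column-of x) (row x) (column<N x))

  -- Equal colours c = f + 1 force distance > c: the kinds of the two lanes agree, and the
  -- lane lemmas apply.
  packing : IsPackingColoring (OneT t) 86 f
  packing u v u≢v fu≡fv n 1+n≤1+c walk =
    apart (column<N u) (column<N v) (same-kind (lane u) (lane v) (lane<4 u) (lane<4 v) kinds)
          (λ e → u≢v (trans (decompose u) (trans e (sym (decompose v))))) same n≤c
          (subst₂ (λ a b → Walk (OneT t) a b n) (decompose u) (decompose v) walk)
    where
    same : colour u ≡ colour v
    same = trans (sym (suc-f u)) (trans (cong (ℕ.suc ∘ toℕ) fu≡fv) (suc-f v))
    n≤c : n ≤ colour u
    n≤c = s≤s⁻¹ (subst (ℕ.suc n ≤_) (cong ℕ.suc (suc-f u)) 1+n≤1+c)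
    kind : ∀ x → colourKind (colour x) ≡ laneKind (lane x)
    kind x = proj₂ (proj₂ (lane-colour (lane x) (column-of x) (row x) (column<N x)))
    kinds : laneKind (lane u) ≡ laneKind (lane v)
    kinds = trans (sym (kind u)) (trans (cong colourKind same) (kind v))

  packing-colouring : PackingChromaticLE (OneT t) 86
  packing-colouring = f , packing

module OddForm where
  open import Data.Integer hiding (_≤_; _<_; _%_; _/_)
  open import Data.Integer.Tactic.RingSolver using (solve-∀)
  open import Data.Nat using (_<_; _/_; z≤n; s≤s)
  import Data.Nat as ℕ
  import Data.Nat.Properties as ℕP
  open import Data.Nat.DivMod using (m%n<n; m≡m%n+[m/n]*n; [m+kn]%n≡m%n)
  open import Data.Integer.Properties using (pos-+)
  open CyclicOffsets using (pos-+*)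

  FourN±1 : ℕ → Set
  FourN±1 t = Σ ℕ λ N' → Σ ℤ λ σ → + t ≡ + 4 * + ColumnCycle.N N' + σ × ∣ σ ∣ ≡ 1

  0≢1 : 0 ≢ 1
  0≢1 ()

  residue-parity : ∀ r q → (r ℕ.+ q ℕ.* 4) % 2 ≡ r % 2
  residue-parity r q = trans (cong (λ z → (r ℕ.+ z) % 2) (sym (ℕP.*-assoc q 2 2))) ([m+kn]%n≡m%n r (q ℕ.* 2) 2)

  q≥18 : ∀ {r q} → r ≤ 3 → 73 ≤ r ℕ.+ q ℕ.* 4 → 18 ≤ q
  q≥18 {r} {q} r≤3 73≤t with 18 ℕP.≤? q
  ... | yes 18≤q = 18≤q
  ... | no  q≱18 = ⊥-elim (ℕP.<⇒≱ (s≤s t≤72) 73≤t)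
    where
    t≤72 : r ℕ.+ q ℕ.* 4 ≤ 72
    t≤72 = ℕP.≤-trans (ℕP.+-mono-≤ r≤3 (ℕP.*-monoˡ-≤ 4 (ℕP.≤-pred (ℕP.≰⇒> q≱18)))) (ℕP.n≤1+n 71)

  -- t = r + 4q with r < 4; oddness forces r ∈ {1, 3}, and t ≥ 73 forces q ≥ 18.
  by-residue : ∀ r q → r < 4 → 73 ≤ r ℕ.+ q ℕ.* 4 → (r ℕ.+ q ℕ.* 4) % 2 ≡ 1 → FourN±1 (r ℕ.+ q ℕ.* 4)
  by-residue 0 q _ _ odd = ⊥-elim (0≢1 (trans (sym (residue-parity 0 q)) odd))
  by-residue 2 q _ _ odd = ⊥-elim (0≢1 (trans (sym (residue-parity 2 q)) odd))
  by-residue 1 q _ 73≤t _ = q ℕ.∸ 18 , + 1 , t≡ , refl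
    where
    open ≡-Reasoning
    t≡ : + (1 ℕ.+ q ℕ.* 4) ≡ + 4 * + (18 ℕ.+ (q ℕ.∸ 18)) + + 1
    t≡ = begin
      + (1 ℕ.+ q ℕ.* 4)                  ≡⟨ pos-+* 1 q 4 ⟩
      + 1 + + q * + 4                    ≡⟨ identity (+ q) ⟩
      + 4 * + q + + 1                    ≡⟨ cong (λ n → + 4 * + n + + 1) (sym (ℕP.m+[n∸m]≡n {18} {q} (q≥18 (s≤s z≤n) 73≤t))) ⟩
      + 4 * + (18 ℕ.+ (q ℕ.∸ 18)) + + 1 ∎
      where
      identity : ∀ q → + 1 + q * + 4 ≡ + 4 * q + + 1
      identity = solve-∀
  by-residue 3 q _ 73≤t _ = q ℕ.∸ 17 , - + 1 , t≡ , refl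
    where
    open ≡-Reasoning
    t≡ : + (3 ℕ.+ q ℕ.* 4) ≡ + 4 * + (18 ℕ.+ (q ℕ.∸ 17)) + - + 1
    t≡ = begin
      + (3 ℕ.+ q ℕ.* 4)                    ≡⟨ pos-+* 3 q 4 ⟩
      + 3 + + q * + 4                      ≡⟨ identity (+ q) ⟩
      + 4 * (+ 1 + + q) + - + 1            ≡⟨ cong (λ z → + 4 * z + - + 1) (sym (pos-+ 1 q)) ⟩
      + 4 * + (1 ℕ.+ q) + - + 1            ≡⟨ cong (λ n → + 4 * + ℕ.suc n + - + 1) (sym (ℕP.m+[n∸m]≡n {17} {q} 17≤q)) ⟩
      + 4 * + (18 ℕ.+ (q ℕ.∸ 17)) + - + 1 ∎
      where
      identity : ∀ q → + 3 + q * + 4 ≡ + 4 * (+ 1 + q) + - + 1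
      identity = solve-∀
      17≤q : 17 ≤ q
      17≤q = ℕP.≤-trans (ℕP.n≤1+n 17) (q≥18 ℕP.≤-refl 73≤t)
  by-residue (ℕ.suc (ℕ.suc (ℕ.suc (ℕ.suc _)))) _ (s≤s (s≤s (s≤s (s≤s ())))) _ _

  odd-form : ∀ t → 73 ≤ t → t % 2 ≡ 1 → FourN±1 t
  odd-form t 73≤t odd = subst FourN±1 (sym t≡) (by-residue (t % 4) (t / 4) (m%n<n t 4)
                          (subst (73 ≤_) t≡ 73≤t) (subst (λ n → n % 2 ≡ 1) t≡ odd))
    where
    t≡ : t ≡ t % 4 ℕ.+ t / 4 ℕ.* 4
    t≡ = m≡m%n+[m/n]*n t 4

-- Write t = 4N ± 1 with N ≥ 18 and use the colouring above; it even uses only 71 colours.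
proposition6 : (t : ℕ) → 73 ≤ t → t % 2 ≡ 1 → PackingChromaticLE (OneT t) 86
proposition6 t 73≤t t-odd with OddForm.odd-form t 73≤t t-odd
... | N' , σ , t≡4N+σ , ∣σ∣≡1 = Colouring.packing-colouring t N' σ t≡4N+σ ∣σ∣≡1 t-odd
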